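{- Let $a>0$, $n$ and $k$ be integers with $1\le k\le \frac{n}{2}$, let $a_0,\dots,a_n$ be integers, and put $u_0=\frac{a}{k}$. (A) Assume there is a prime $p\ge k+2$ such that $p\mid \prod_{i=1}^k(a+n-k+i)$, $p\nmid a_0a_n$, and $p\nmid\prod_{i=1}^k(a+i)$. Suppose further that either $p\ge \min(2u_0,\,k+u_0)$, or ($p>2k$ and $p^2-p\ge a$). Then $f_{n,a}(x)$ has no factor of degree $k$ in $\mathbb{Q}[x]$. (B) Assume there is a prime $p\ge k+2$ such that $p\mid \prod_{i=1}^k (n-k+i)(a+n-k+i)$ and $p\nmid \prod_{i=1}^k(a+i)$, and such that either $p\ge\min(2u_0,\,k+u_0)$, or ($p>2k$ and $p^2-p\ge a$). Then the generalised Laguerre polynomial $L_n^{(a)}(x)$ has no factor of degree $k$ in $\mathbb{Q}[x]$.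
   Context: For integers $n\ge1$, $a\ge0$ and integers $a_0,\dots,a_n$, $f_{n,a}(x)=\sum_{j=0}^n a_j\frac{x^j}{(j+a)!}$. The generalised Laguerre polynomial is $L_n^{(a)}(x)=\sum_{j=0}^{n}\frac{(n+a)(n-1+a)\cdots(j+1+a)(-x)^j}{(n-j)!\,j!}$. -}

module Defs where

open import Data.Nat as ℕ using (ℕ; zero; suc; _+_; _*_; _∸_; _!; _≤_; _<_)
open import Data.Nat.Properties using (_!≢0; _!*_!≢0)
open import Data.Nat.Divisibility as ℕD using ()
open import Data.Integer as ℤ using (ℤ; +_)
open import Data.Integer.Divisibility as ℤD using ()
open import Data.Rational as ℚ using (ℚ; 0ℚ; _/_; _⊓_)
open import Data.List using (List; []; _∷_; length; map; upTo)
open import Data.Product using (Σ; _×_; ∃)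
open import Relation.Binary.PropositionalEquality using (_≡_; _≢_)
open import Relation.Nullary using (¬_)

prodℕ : ℕ → (ℕ → ℕ) → ℕ
prodℕ zero    f = 1
prodℕ (suc k) f = prodℕ k f * f (suc k)

sumℚ : ℕ → (ℕ → ℚ) → ℚ
sumℚ zero    f = f 0
sumℚ (suc m) f = sumℚ m f ℚ.+ f (suc m)

-- rational number z/d, with the (never used) convention z/0 = 0
frac : ℤ → ℕ → ℚ
frac z zero    = 0ℚ
frac z (suc d) = z / suc d

ℕtoℚ : ℕ → ℚ
ℕtoℚ m = + m / 1

-- Polynomials in ℚ[x] as coefficient lists (constant term first)

Poly : Set
Poly = List ℚ

coeff : Poly → ℕ → ℚ
coeff []       _       = 0ℚ
coeff (c ∷ cs) zero    = c
coeff (c ∷ cs) (suc i) = coeff cs i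

mulCoeff : Poly → Poly → ℕ → ℚ
mulCoeff g h m = sumℚ m (λ i → coeff g i ℚ.* coeff h (m ∸ i))

HasDegree : Poly → ℕ → Set
HasDegree g k = (length g ≡ suc k) × (coeff g k ≢ 0ℚ)

HasFactorOfDegree : Poly → ℕ → Set
HasFactorOfDegree f k =
  Σ Poly λ g → Σ Poly λ h → HasDegree g k × (∀ m → mulCoeff g h m ≡ coeff f m)

fna : (n a : ℕ) → (ℕ → ℤ) → Poly
fna n a as = map (λ j → _/_ (as j) ((j + a) !) {{(j + a) !≢0}}) (upTo (suc n))

-- L_n^{(a)}(x) = Σ_{j=0}^{n} (n+a)(n-1+a)⋯(j+1+a) (-x)^j / ((n-j)! j!)
-- (n+a)⋯(j+1+a) = ∏_{i=1}^{n-j} (j+i+a)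
laguerre : (n a : ℕ) → Poly
laguerre n a = map coef (upTo (suc n))
  where
  coef : ℕ → ℚ
  coef j = _/_ ((ℤ.- (+ 1)) ℤ.^ j ℤ.* + prodℕ (n ∸ j) (λ i → j + i + a))
               ((n ∸ j) ! * j !) {{(n ∸ j) !* j !≢0}}

u₀ : ℕ → ℕ → ℚ
u₀ a k = frac (+ a) k

SizeCond : (p a k : ℕ) → Set
SizeCond p a k =
  ((ℕtoℚ 2 ℚ.* u₀ a k) ⊓ (ℕtoℚ k ℚ.+ u₀ a k) ℚ.≤ ℕtoℚ p)
  ⊎ ((2 * k < p) × (a ≤ p * p ∸ p))
  where open import Data.Sum using (_⊎_)

{-# OPTIONS --safe #-}
module Submission where

-- Fix the prime p, write ν for the p-adic valuation and cᵢ for the coefficients of f, of degree n.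
-- Suppose f = g h with deg g = k.  If every point (i, ν cᵢ) with i ≥ 1 lies strictly above the line
-- of slope −1/k through (0, ν c₀), then the last minimisers of k ν gᵢ + i and of k ν hⱼ + j are both 0
-- (otherwise the coefficient of f at their sum would lie on or below that line), so ν gᵢ ≥ ν g₀ for all i.
-- At the first index b ≤ deg h ≤ n − k where ν h is minimal, the coefficient of f then has valuation
-- exactly ν g₀ + ν h_b, which is at most ν cₙ; this is impossible if ν cₙ < ν cᵢ for all i ≤ n − k.
-- For f_{n,a} and L_n^{(a)} the latter condition comes from a multiple of p among the top factors
-- n − k + 1 … n (+ a), and the former from the estimate k ν ((a + 1) ⋯ (a + i)) < i, which is where
-- p ≥ k + 2, p ∤ (a + 1) ⋯ (a + k) and the size condition enter, via Legendre's (p − 1) ν (N!) < N.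

open import Data.Nat as ℕ using (ℕ; zero; suc; _^_; _!)
import Data.Nat.Properties as ℕP
open import Data.Nat.Divisibility as ℕD using (divides)
open import Data.Nat.Primality using (Prime; euclidsLemma)
open import Data.Integer as ℤ using (ℤ; +_; ∣_∣; 1ℤ)
import Data.Integer.Properties as ℤP
import Data.Integer.Divisibility.Signed as ℤS
open import Data.Integer.GCD using (gcd)
open import Data.Rational as ℚ using (ℚ; mkℚ; ↥_; ↧_; ↧ₙ_; 0ℚ; _/_)
import Data.Rational.Properties as ℚP
open import Data.Sum using (_⊎_; inj₁; inj₂; [_,_]′)
open import Data.Product using (Σ; _×_; _,_; proj₁; proj₂)
open import Data.Empty using (⊥-elim)
open import Relation.Nullary using (¬_; yes; no)
open import Relation.Binary.PropositionalEquality
open import Relation.Binary.Definitions using (tri<; tri≈; tri>)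
open import Function using (id; _∘_)
open import Data.List using ([]; _∷_; length)
open import Defs
open import Data.Integer.Solver using (module +-*-Solver)

module NatDifference where

  open import Data.Integer
  open import Data.Integer.Properties
  open +-*-Solver

  diff-cancelʳ : ∀ m n o → + (m ℕ.+ o) - + (n ℕ.+ o) ≡ + m - + n
  diff-cancelʳ m n o rewrite pos-+ m o | pos-+ n o =
    solve 3 (λ m n o → (m :+ o) :- (n :+ o) := m :- n) refl (+ m) (+ n) (+ o)

  diff-+ : ∀ m n o r → + (m ℕ.+ o) - + (n ℕ.+ r) ≡ (+ m - + n) + (+ o - + r)
  diff-+ m n o r rewrite pos-+ m o | pos-+ n r =
    solve 4 (λ m n o r → (m :+ o) :- (n :+ r) := (m :- n) :+ (o :- r)) refl (+ m) (+ n) (+ o) (+ r)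

  private
    diff-+-restoreˡ : ∀ m n o → + m - + n + (+ n + + o) ≡ + (m ℕ.+ o)
    diff-+-restoreˡ m n o rewrite pos-+ m o =
      solve 3 (λ m n o → m :- n :+ (n :+ o) := m :+ o) refl (+ m) (+ n) (+ o)

    diff-+-restoreʳ : ∀ m n o → + m - + n + (+ o + + n) ≡ + (m ℕ.+ o)
    diff-+-restoreʳ m n o rewrite pos-+ m o =
      solve 3 (λ m n o → m :- n :+ (o :+ n) := m :+ o) refl (+ m) (+ n) (+ o)

    +-cancelʳ-≤ : ∀ {i j} w → i + w ≤ j + w → i ≤ j
    +-cancelʳ-≤ {i} {j} w h = subst₂ _≤_ (restore i) (restore j) (+-monoˡ-≤ (- w) h)
      where restore : ∀ x → x + w + - w ≡ x
            restore x = solve 2 (λ x w → x :+ w :+ (:- w) := x) refl x w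

    +-cancelʳ-< : ∀ {i j} w → i + w < j + w → i < j
    +-cancelʳ-< {i} {j} w h = subst₂ _<_ (restore i) (restore j) (+-monoˡ-< (- w) h)
      where restore : ∀ x → x + w + - w ≡ x
            restore x = solve 2 (λ x w → x :+ w :+ (:- w) := x) refl x w

  diff-≤⇒ : ∀ a b c d → + a - + b ≤ + c - + d → a ℕ.+ d ℕ.≤ c ℕ.+ b
  diff-≤⇒ a b c d h =
    drop‿+≤+ (subst₂ _≤_ (diff-+-restoreˡ a b d) (diff-+-restoreʳ c d b) (+-monoˡ-≤ (+ b + + d) h))

  ≤⇒diff-≤ : ∀ a b c d → a ℕ.+ d ℕ.≤ c ℕ.+ b → + a - + b ≤ + c - + d
  ≤⇒diff-≤ a b c d h = +-cancelʳ-≤ (+ b + + d)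
    (subst₂ _≤_ (sym (diff-+-restoreˡ a b d)) (sym (diff-+-restoreʳ c d b)) (+≤+ h))

  diff-<⇒ : ∀ a b c d → + a - + b < + c - + d → a ℕ.+ d ℕ.< c ℕ.+ b
  diff-<⇒ a b c d h =
    drop‿+<+ (subst₂ _<_ (diff-+-restoreˡ a b d) (diff-+-restoreʳ c d b) (+-monoˡ-< (+ b + + d) h))

  <⇒diff-< : ∀ a b c d → a ℕ.+ d ℕ.< c ℕ.+ b → + a - + b < + c - + d
  <⇒diff-< a b c d h = +-cancelʳ-< (+ b + + d)
    (subst₂ _<_ (sym (diff-+-restoreˡ a b d)) (sym (diff-+-restoreʳ c d b)) (+<+ h))

  <⇒1+diff≤ : ∀ x y t → x < y → 1ℤ + (x - t) ≤ y - t
  <⇒1+diff≤ x y t h = subst (_≤ y - t) (solve 2 (λ x t → (con 1ℤ :+ x) :- t := con 1ℤ :+ (x :- t)) refl x t)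
                         (+-monoˡ-≤ (- t) (i<j⇒suc[i]≤j h))

  <1+⇒≤ : ∀ {x y} → x < 1ℤ + y → x ≤ y
  <1+⇒≤ {x} {y} h = +-cancelʳ-≤ 1ℤ (subst₂ _≤_ (+-comm 1ℤ x) (+-comm 1ℤ y) (i<j⇒suc[i]≤j h))

^-monoʳ-∣ : ∀ b {m n} → m ℕ.≤ n → b ^ m ℕD.∣ b ^ n
^-monoʳ-∣ b {m} {n} m≤n = subst (λ z → b ^ m ℕD.∣ b ^ z) (ℕP.m+[n∸m]≡n m≤n)
  (subst (b ^ m ℕD.∣_) (sym (ℕP.^-distribˡ-+-* b m (n ℕ.∸ m))) (ℕD.m∣m*n (b ^ (n ℕ.∸ m))))

-- The prime is given as q + 2, so that p − 1 = suc q involves no truncated subtraction.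
module Valuation (q : ℕ) (p-prime : Prime (suc (suc q))) where

  open import Data.Nat
  open import Data.Nat.Properties
  open import Data.Nat.Divisibility

  p : ℕ
  p = suc (suc q)

  private
    νF : ℕ → ℕ → ℕ
    νF zero    n = 0
    νF (suc f) n with p ∣? n
    ... | yes (divides r _) = suc (νF f r)
    ... | no _              = 0

    νF-exact : ∀ f n → n ≢ 0 → n ≤ f → (p ^ νF f n ∣ n) × ¬ (p ^ suc (νF f n) ∣ n)
    νF-exact zero n n≢0 n≤0 = ⊥-elim (n≢0 (n≤0⇒n≡0 n≤0))
    νF-exact (suc f) n n≢0 n≤f with p ∣? n
    ... | no p∤n = divides n (sym (*-identityʳ n)) , λ h → p∤n (subst (_∣ n) (*-identityʳ p) h)
    ... | yes (divides r n≡rp) = p^1+ν∣n , p^2+ν∤n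
      where
      r≢0 : r ≢ 0
      r≢0 r≡0 = n≢0 (trans n≡rp (cong (_* p) r≡0))
      r<n : r < n
      r<n = subst (r <_) (sym n≡rp) (m<m*n r p {{≢-nonZero r≢0}} (s≤s (s≤s z≤n)))
      ih : (p ^ νF f r ∣ r) × ¬ (p ^ suc (νF f r) ∣ r)
      ih = νF-exact f r r≢0 (≤-pred (≤-trans r<n n≤f))
      p^1+ν∣n : p * p ^ νF f r ∣ n
      p^1+ν∣n = subst (p * p ^ νF f r ∣_) (trans (*-comm p r) (sym n≡rp)) (*-monoʳ-∣ p (proj₁ ih))
      p^2+ν∤n : ¬ (p * (p * p ^ νF f r) ∣ n)
      p^2+ν∤n h = proj₂ ih (*-cancelˡ-∣ p (subst (p * (p * p ^ νF f r) ∣_) (trans n≡rp (*-comm r p)) h))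

  -- The p-adic valuation, computed with n itself as the fuel (ν 0 = 0 is junk); abstract, so that
  -- the fuel recursion is never unfolded during type checking.
  abstract
    ν : ℕ → ℕ
    ν n = νF n n

    p^ν∣ : ∀ {n} → n ≢ 0 → p ^ ν n ∣ n
    p^ν∣ {n} n≢0 = proj₁ (νF-exact n n n≢0 ≤-refl)

    p^1+ν∤ : ∀ {n} → n ≢ 0 → ¬ (p ^ suc (ν n) ∣ n)
    p^1+ν∤ {n} n≢0 = proj₂ (νF-exact n n n≢0 ≤-refl)

  p^e∣⇒e≤ν : ∀ {n e} → n ≢ 0 → p ^ e ∣ n → e ≤ ν n
  p^e∣⇒e≤ν {n} {e} n≢0 d with e ≤? ν n
  ... | yes h = h
  ... | no h  = ⊥-elim (p^1+ν∤ n≢0 (∣-trans (^-monoʳ-∣ p (≰⇒> h)) d))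

  ν-unique : ∀ {n e} → n ≢ 0 → p ^ e ∣ n → ¬ (p ^ suc e ∣ n) → ν n ≡ e
  ν-unique {n} {e} n≢0 d nd with <-cmp (ν n) e
  ... | tri≈ _ eq _ = eq
  ... | tri< lt _ _ = ⊥-elim (p^1+ν∤ n≢0 (∣-trans (^-monoʳ-∣ p lt) d))
  ... | tri> _ _ gt = ⊥-elim (nd (∣-trans (^-monoʳ-∣ p gt) (p^ν∣ n≢0)))

  ν-decomposition : ∀ {n} → n ≢ 0 → Σ ℕ λ r → (n ≡ r * p ^ ν n) × ¬ (p ∣ r)
  ν-decomposition {n} n≢0 with p^ν∣ n≢0
  ... | divides r n≡r*p^ν = r , n≡r*p^ν , λ { (divides s r≡sp) →
          p^1+ν∤ n≢0 (divides s (trans n≡r*p^ν (trans (cong (_* p ^ ν n) r≡sp) (*-assoc s p _)))) }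

  ν-* : ∀ {m n} → m ≢ 0 → n ≢ 0 → ν (m * n) ≡ ν m + ν n
  ν-* {m} {n} m≢0 n≢0 with ν-decomposition m≢0 | ν-decomposition n≢0
  ... | r , m≡ , p∤r | s , n≡ , p∤s = ν-unique mn≢0 (divides (r * s) mn≡) p^1+∤mn
    where
    open ≡-Reasoning
    a = ν m
    b = ν n
    mn≢0 : m * n ≢ 0
    mn≢0 e = [ m≢0 , n≢0 ]′ (m*n≡0⇒m≡0∨n≡0 m e)
    mn≡ : m * n ≡ (r * s) * p ^ (a + b)
    mn≡ = begin
      m * n                       ≡⟨ cong₂ _*_ m≡ n≡ ⟩
      (r * p ^ a) * (s * p ^ b)   ≡⟨ *-assoc r (p ^ a) _ ⟩
      r * (p ^ a * (s * p ^ b))   ≡⟨ cong (r *_) (trans (sym (*-assoc (p ^ a) s _))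
                                       (trans (cong (_* p ^ b) (*-comm (p ^ a) s)) (*-assoc s (p ^ a) _))) ⟩
      r * (s * (p ^ a * p ^ b))   ≡⟨ sym (*-assoc r s _) ⟩
      (r * s) * (p ^ a * p ^ b)   ≡⟨ cong ((r * s) *_) (sym (^-distribˡ-+-* p a b)) ⟩
      (r * s) * p ^ (a + b)       ∎
    p^1+∤mn : ¬ (p ^ suc (a + b) ∣ m * n)
    p^1+∤mn h = [ p∤r , p∤s ]′ (euclidsLemma r s p-prime
                  (*-cancelʳ-∣ (p ^ (a + b)) {{m^n≢0 p (a + b)}} (subst (p ^ suc (a + b) ∣_) mn≡ h)))

  ∤⇒ν≡0 : ∀ {n} → ¬ (p ∣ n) → ν n ≡ 0
  ∤⇒ν≡0 {n} p∤n = ν-unique (λ { refl → p∤n (divides 0 refl) }) (divides n (sym (*-identityʳ n)))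
                    λ h → p∤n (subst (_∣ n) (*-identityʳ p) h)

  ∣⇒1≤ν : ∀ {n} → n ≢ 0 → p ∣ n → 1 ≤ ν n
  ∣⇒1≤ν {n} n≢0 d = p^e∣⇒e≤ν n≢0 (subst (_∣ n) (sym (*-identityʳ p)) d)

  ν-mono-∣ : ∀ {m n} → n ≢ 0 → m ∣ n → ν m ≤ ν n
  ν-mono-∣ {m} {n} n≢0 d = p^e∣⇒e≤ν n≢0 (∣-trans (p^ν∣ m≢0) d)
    where
    m≢0 : m ≢ 0
    m≢0 refl = n≢0 (0∣⇒≡0 d)

  ν-1 : ν 1 ≡ 0
  ν-1 = ∤⇒ν≡0 (λ d → p≢1 (∣1⇒≡1 d))
    where
    p≢1 : p ≢ 1
    p≢1 ()

  ν-p* : ∀ {x} → x ≢ 0 → ν (p * x) ≡ suc (ν x)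
  ν-p* {x} x≢0 = trans (ν-* (λ ()) x≢0) (cong (_+ ν x) ν-p)
    where
    p²∤p : ¬ (p ^ 2 ∣ p)
    p²∤p d = <-irrefl refl (<-≤-trans (subst (p <_) (cong (p *_) (sym (*-identityʳ p)))
                                          (m<m*n p p (s≤s (s≤s z≤n)))) (∣⇒≤ d))
    ν-p : ν p ≡ 1
    ν-p = ν-unique (λ ()) (divides 1 (sym (trans (*-identityˡ (p * 1)) (*-identityʳ p)))) p²∤p

module RationalValuation (q : ℕ) (p-prime : Prime (suc (suc q))) where

  open Valuation q p-prime public
  open NatDifference

  νℤ : ℤ → ℕ
  νℤ z = ν ∣ z ∣

  νℚ : ℚ → ℤ
  νℚ x = + νℤ (↥ x) ℤ.- + ν (↧ₙ x)

  private
    ∣∣≢0 : ∀ {z} → z ≢ + 0 → ∣ z ∣ ≢ 0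
    ∣∣≢0 z≢0 e = z≢0 (ℤP.∣i∣≡0⇒i≡0 e)

    ↥≢0 : ∀ {x} → x ≢ 0ℚ → ↥ x ≢ + 0
    ↥≢0 {x} x≢0 e = x≢0 (ℚP.↥p≡0⇒p≡0 x e)

    ℤ*≢0 : ∀ {i j} → i ≢ + 0 → j ≢ + 0 → i ℤ.* j ≢ + 0
    ℤ*≢0 {i} {j} i≢0 j≢0 e with ℕP.m*n≡0⇒m≡0∨n≡0 ∣ i ∣ (trans (sym (ℤP.abs-* i j)) (cong ∣_∣ e))
    ... | inj₁ h = ∣∣≢0 i≢0 h
    ... | inj₂ h = ∣∣≢0 j≢0 h

    *≡⇒≢0ˡ : ∀ m n {o} → m ℕ.* n ≡ o → o ≢ 0 → m ≢ 0
    *≡⇒≢0ˡ m n refl o≢0 refl = o≢0 refl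

    *≡⇒≢0ʳ : ∀ m n {o} → m ℕ.* n ≡ o → o ≢ 0 → n ≢ 0
    *≡⇒≢0ʳ m n refl o≢0 refl = o≢0 (ℕP.*-zeroʳ m)

  νℤ-* : ∀ {i j} → i ≢ + 0 → j ≢ + 0 → νℤ (i ℤ.* j) ≡ νℤ i ℕ.+ νℤ j
  νℤ-* {i} {j} i≢0 j≢0 = trans (cong ν (ℤP.abs-* i j)) (ν-* (∣∣≢0 i≢0) (∣∣≢0 j≢0))

  /-≢0 : ∀ i n .{{_ : ℕ.NonZero n}} → i ≢ + 0 → i / n ≢ 0ℚ
  /-≢0 i n i≢0 e = i≢0 (trans (sym (ℚP.↥-/ i n)) (cong (ℤ._* gcd i (+ n)) (ℚP.p≡0⇒↥p≡0 _ e)))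

  -- i / n is i and n divided by their gcd, whose valuation cancels.
  νℚ-/ : ∀ i n .{{_ : ℕ.NonZero n}} → i ≢ + 0 → νℚ (i / n) ≡ + νℤ i ℤ.- + ν n
  νℚ-/ i n i≢0 = trans (sym (diff-cancelʳ (νℤ (↥ x)) (ν (↧ₙ x)) (ν G)))
                        (cong₂ (λ a b → + a ℤ.- + b) num den)
    where
    x = i / n
    g = gcd i (+ n)
    G = ∣ g ∣
    num≡ : ∣ ↥ x ∣ ℕ.* G ≡ ∣ i ∣
    num≡ = trans (sym (ℤP.abs-* (↥ x) g)) (cong ∣_∣ (ℚP.↥-/ i n))
    den≡ : ↧ₙ x ℕ.* G ≡ n
    den≡ = trans (sym (ℤP.abs-* (↧ x) g)) (cong ∣_∣ (ℚP.↧-/ i n))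
    num : νℤ (↥ x) ℕ.+ ν G ≡ νℤ i
    num = trans (sym (ν-* (*≡⇒≢0ˡ ∣ ↥ x ∣ G num≡ (∣∣≢0 i≢0)) (*≡⇒≢0ʳ ∣ ↥ x ∣ G num≡ (∣∣≢0 i≢0)))) (cong ν num≡)
    den : ν (↧ₙ x) ℕ.+ ν G ≡ ν n
    den = trans (sym (ν-* (*≡⇒≢0ˡ (↧ₙ x) G den≡ (ℕ.≢-nonZero⁻¹ n)) (*≡⇒≢0ʳ (↧ₙ x) G den≡ (ℕ.≢-nonZero⁻¹ n)))) (cong ν den≡)

  νℚ-* : ∀ x y → x ≢ 0ℚ → y ≢ 0ℚ → (x ℚ.* y ≢ 0ℚ) × (νℚ (x ℚ.* y) ≡ νℚ x ℤ.+ νℚ y)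
  νℚ-* x@(mkℚ nx dx _) y@(mkℚ ny dy _) x≢0 y≢0 =
    /-≢0 (nx ℤ.* ny) D nxny≢0 ,
    trans (νℚ-/ (nx ℤ.* ny) D nxny≢0)
      (trans (cong₂ (λ a b → + a ℤ.- + b) (νℤ-* (↥≢0 x≢0) (↥≢0 y≢0)) (ν-* (λ ()) (λ ())))
             (diff-+ (νℤ nx) (ν (suc dx)) (νℤ ny) (ν (suc dy))))
    where
    D : ℕ
    D = suc dx ℕ.* suc dy
    nxny≢0 : nx ℤ.* ny ≢ + 0
    nxny≢0 = ℤ*≢0 (↥≢0 x≢0) (↥≢0 y≢0)

  private
    ∣⇒∣∣∣ : ∀ {d} z → (+ d) ℤS.∣ z → d ℕD.∣ ∣ z ∣
    ∣⇒∣∣∣ {d} z h = ℤS.∣⇒∣ᵤ {+ d} {z} h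

    ∣∣∣⇒∣ : ∀ {d} z → d ℕD.∣ ∣ z ∣ → (+ d) ℤS.∣ z
    ∣∣∣⇒∣ {d} z h = ℤS.∣ᵤ⇒∣ {+ d} {z} h

  νℤ-+-≥ : ∀ A B e → p ^ e ℕD.∣ ∣ A ∣ → p ^ e ℕD.∣ ∣ B ∣ → A ℤ.+ B ≢ + 0 → e ℕ.≤ νℤ (A ℤ.+ B)
  νℤ-+-≥ A B e dA dB A+B≢0 = p^e∣⇒e≤ν (∣∣≢0 A+B≢0)
    (∣⇒∣∣∣ (A ℤ.+ B) (ℤS.∣m∣n⇒∣m+n {+ (p ^ e)} {A} {B} (∣∣∣⇒∣ A dA) (∣∣∣⇒∣ B dB)))

  νℤ-+-exact : ∀ A B e → p ^ e ℕD.∣ ∣ A ∣ → ¬ (p ^ suc e ℕD.∣ ∣ A ∣) → p ^ suc e ℕD.∣ ∣ B ∣ →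
               (A ℤ.+ B ≢ + 0) × (νℤ (A ℤ.+ B) ≡ e)
  νℤ-+-exact A B e dA ndA dB = A+B≢0 , ν-unique (∣∣≢0 A+B≢0) d nd
    where
    nd : ¬ (p ^ suc e ℕD.∣ ∣ A ℤ.+ B ∣)
    nd h = ndA (∣⇒∣∣∣ A (ℤS.∣m+n∣n⇒∣m {+ (p ^ suc e)} {A} {B} (∣∣∣⇒∣ (A ℤ.+ B) h) (∣∣∣⇒∣ B dB)))
    A+B≢0 : A ℤ.+ B ≢ + 0
    A+B≢0 e0 = nd (subst (λ z → p ^ suc e ℕD.∣ ∣ z ∣) (sym e0) (divides 0 refl))
    d : p ^ e ℕD.∣ ∣ A ℤ.+ B ∣
    d = ∣⇒∣∣∣ (A ℤ.+ B) (ℤS.∣m∣n⇒∣m+n {+ (p ^ e)} {A} {B} (∣∣∣⇒∣ A dA)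
          (∣∣∣⇒∣ B (ℕD.∣-trans (^-monoʳ-∣ p (ℕP.n≤1+n e)) dB)))

  private
    νℤ-*-den : ∀ n d → n ≢ + 0 → νℤ (n ℤ.* + suc d) ≡ νℤ n ℕ.+ ν (suc d)
    νℤ-*-den n d n≢0 = νℤ-* n≢0 (λ ())

    ∣∣*den≢0 : ∀ n d → n ≢ + 0 → ∣ n ℤ.* + suc d ∣ ≢ 0
    ∣∣*den≢0 n d n≢0 = ∣∣≢0 (ℤ*≢0 n≢0 (λ ()))

  -- x + y is (nx·dy + ny·dx) / (dx·dy) by definition; the valuations of the two summands of the
  -- numerator differ by νℚ y - νℚ x.
  νℚ-+-≥ : ∀ x y → x ≢ 0ℚ → y ≢ 0ℚ → x ℚ.+ y ≢ 0ℚ → νℚ x ℤ.≤ νℚ y → νℚ x ℤ.≤ νℚ (x ℚ.+ y)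
  νℚ-+-≥ x@(mkℚ nx dx _) y@(mkℚ ny dy _) x≢0 y≢0 x+y≢0 νx≤νy =
    subst (νℚ x ℤ.≤_) (sym (νℚ-/ (A ℤ.+ B) D A+B≢0))
      (≤⇒diff-≤ (νℤ nx) (ν (suc dx)) (νℤ (A ℤ.+ B)) (ν D) ineq)
    where
    A B : ℤ
    A = nx ℤ.* + suc dy
    B = ny ℤ.* + suc dx
    D : ℕ
    D = suc dx ℕ.* suc dy
    νA : νℤ A ≡ νℤ nx ℕ.+ ν (suc dy)
    νA = νℤ-*-den nx dy (↥≢0 x≢0)
    νA≤νB : νℤ A ℕ.≤ νℤ B
    νA≤νB = subst₂ ℕ._≤_ (sym νA) (sym (νℤ-*-den ny dx (↥≢0 y≢0)))
              (diff-≤⇒ (νℤ nx) (ν (suc dx)) (νℤ ny) (ν (suc dy)) νx≤νy)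
    A+B≢0 : A ℤ.+ B ≢ + 0
    A+B≢0 e = x+y≢0 (trans (cong (_/ D) e) (ℚP.0/n≡0 D))
    νA≤νA+B : νℤ A ℕ.≤ νℤ (A ℤ.+ B)
    νA≤νA+B = νℤ-+-≥ A B (νℤ A) (p^ν∣ (∣∣*den≢0 nx dy (↥≢0 x≢0)))
                (ℕD.∣-trans (^-monoʳ-∣ p νA≤νB) (p^ν∣ (∣∣*den≢0 ny dx (↥≢0 y≢0)))) A+B≢0
    ineq : νℤ nx ℕ.+ ν D ℕ.≤ νℤ (A ℤ.+ B) ℕ.+ ν (suc dx)
    ineq = begin
      νℤ nx ℕ.+ ν D                              ≡⟨ cong (νℤ nx ℕ.+_) (ν-* (λ ()) (λ ())) ⟩
      νℤ nx ℕ.+ (ν (suc dx) ℕ.+ ν (suc dy))      ≡⟨ cong (νℤ nx ℕ.+_) (ℕP.+-comm (ν (suc dx)) _) ⟩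
      νℤ nx ℕ.+ (ν (suc dy) ℕ.+ ν (suc dx))      ≡⟨ sym (ℕP.+-assoc (νℤ nx) _ _) ⟩
      νℤ nx ℕ.+ ν (suc dy) ℕ.+ ν (suc dx)        ≤⟨ ℕP.+-monoˡ-≤ (ν (suc dx)) (subst (ℕ._≤ νℤ (A ℤ.+ B)) νA νA≤νA+B) ⟩
      νℤ (A ℤ.+ B) ℕ.+ ν (suc dx)                ∎
      where open ℕP.≤-Reasoning

  νℚ-+-exact : ∀ x y → x ≢ 0ℚ → y ≢ 0ℚ → νℚ x ℤ.< νℚ y → (x ℚ.+ y ≢ 0ℚ) × (νℚ (x ℚ.+ y) ≡ νℚ x)
  νℚ-+-exact x@(mkℚ nx dx _) y@(mkℚ ny dy _) x≢0 y≢0 νx<νy =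
    /-≢0 (A ℤ.+ B) D (proj₁ exact) ,
    trans (νℚ-/ (A ℤ.+ B) D (proj₁ exact))
      (trans (cong₂ (λ a b → + a ℤ.- + b) (trans (proj₂ exact) νA) (ν-* (λ ()) (λ ())))
             (diff-cancelʳ (νℤ nx) (ν (suc dx)) (ν (suc dy))))
    where
    A B : ℤ
    A = nx ℤ.* + suc dy
    B = ny ℤ.* + suc dx
    D : ℕ
    D = suc dx ℕ.* suc dy
    νA : νℤ A ≡ νℤ nx ℕ.+ ν (suc dy)
    νA = νℤ-*-den nx dy (↥≢0 x≢0)
    νA<νB : νℤ A ℕ.< νℤ B
    νA<νB = subst₂ ℕ._<_ (sym νA) (sym (νℤ-*-den ny dx (↥≢0 y≢0)))
              (diff-<⇒ (νℤ nx) (ν (suc dx)) (νℤ ny) (ν (suc dy)) νx<νy)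
    ∣A∣≢0 : ∣ A ∣ ≢ 0
    ∣A∣≢0 = ∣∣*den≢0 nx dy (↥≢0 x≢0)
    exact : (A ℤ.+ B ≢ + 0) × (νℤ (A ℤ.+ B) ≡ νℤ A)
    exact = νℤ-+-exact A B (νℤ A) (p^ν∣ ∣A∣≢0) (p^1+ν∤ ∣A∣≢0)
              (ℕD.∣-trans (^-monoʳ-∣ p νA<νB) (p^ν∣ (∣∣*den≢0 ny dx (↥≢0 y≢0))))

coeff-beyond-length : ∀ (l : Poly) i → length l ℕ.≤ i → coeff l i ≡ 0ℚ
coeff-beyond-length []      i       _           = refl
coeff-beyond-length (x ∷ l) (suc i) (ℕ.s≤s l≤i) = coeff-beyond-length l i l≤i

sumℚ-single : ∀ m (t : ℕ → ℚ) i₀ → i₀ ℕ.≤ m → (∀ i → i ℕ.≤ m → i ≢ i₀ → t i ≡ 0ℚ) → sumℚ m t ≡ t i₀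
sumℚ-single zero t .zero ℕ.z≤n _ = refl
sumℚ-single (suc m) t i₀ i₀≤ t≡0 with i₀ ℕ.≟ suc m
... | yes refl = trans (cong (ℚ._+ t (suc m)) (sum≡0 m (λ i i≤m → t≡0 i (ℕP.m≤n⇒m≤1+n i≤m) (ℕP.<⇒≢ (ℕ.s≤s i≤m)))))
                       (ℚP.+-identityˡ _)
  where
  sum≡0 : ∀ m' → (∀ i → i ℕ.≤ m' → t i ≡ 0ℚ) → sumℚ m' t ≡ 0ℚ
  sum≡0 zero     z = z 0 ℕ.z≤n
  sum≡0 (suc m') z = cong₂ ℚ._+_ (sum≡0 m' (λ i i≤m' → z i (ℕP.m≤n⇒m≤1+n i≤m'))) (z (suc m') ℕP.≤-refl)
... | no i₀≢ = trans (cong₂ ℚ._+_ (sumℚ-single m t i₀ (ℕP.≤-pred (ℕP.≤∧≢⇒< i₀≤ i₀≢))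
                                     (λ i i≤m → t≡0 i (ℕP.m≤n⇒m≤1+n i≤m)))
                                  (t≡0 (suc m) ℕP.≤-refl (i₀≢ ∘ sym)))
                     (ℚP.+-identityʳ _)

≤-suc-split : ∀ {i L} → i ℕ.≤ suc L → i ℕ.≤ L ⊎ i ≡ suc L
≤-suc-split {i} {L} i≤ with i ℕ.≟ suc L
... | yes e  = inj₂ e
... | no i≢  = inj₁ (ℕP.≤-pred (ℕP.≤∧≢⇒< i≤ i≢))

record LastMinimiser (P : ℕ → ℚ) (W : ℕ → ℤ) (L : ℕ) : Set where
  constructor lastMin
  field
    index    : ℕ
    nonzero  : P index ≢ 0ℚ
    minimal  : ∀ i → i ℕ.≤ L → P i ≢ 0ℚ → W index ℤ.≤ W i
    strict   : ∀ i → i ℕ.≤ L → index ℕ.< i → P i ≢ 0ℚ → W index ℤ.< W i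

record FirstMinimiser (P : ℕ → ℚ) (W : ℕ → ℤ) (L : ℕ) : Set where
  constructor firstMin
  field
    index    : ℕ
    nonzero  : P index ≢ 0ℚ
    minimal  : ∀ i → i ℕ.≤ L → P i ≢ 0ℚ → W index ℤ.≤ W i
    strict   : ∀ i → i ℕ.< index → P i ≢ 0ℚ → W index ℤ.< W i

lastMinimiser : ∀ P W L → P 0 ≢ 0ℚ → LastMinimiser P W L
lastMinimiser P W zero P₀≢0 =
  lastMin 0 P₀≢0 (λ { .zero ℕ.z≤n _ → ℤP.≤-refl }) (λ { .zero ℕ.z≤n () _ })
lastMinimiser P W (suc L) P₀≢0 with lastMinimiser P W L P₀≢0 | P (suc L) ℚP.≟ 0ℚ
... | lastMin a Pa≢0 min strict | yes P≡0 = lastMin a Pa≢0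
  (λ i i≤ Pi≢0 → [ (λ i≤L → min i i≤L Pi≢0) , (λ { refl → ⊥-elim (Pi≢0 P≡0) }) ]′ (≤-suc-split i≤))
  (λ i i≤ a<i Pi≢0 → [ (λ i≤L → strict i i≤L a<i Pi≢0) , (λ { refl → ⊥-elim (Pi≢0 P≡0) }) ]′ (≤-suc-split i≤))
... | lastMin a Pa≢0 min strict | no P≢0 with W (suc L) ℤP.≤? W a
...   | yes W≤ = lastMin (suc L) P≢0
  (λ i i≤ Pi≢0 → [ (λ i≤L → ℤP.≤-trans W≤ (min i i≤L Pi≢0)) , (λ { refl → ℤP.≤-refl }) ]′ (≤-suc-split i≤))
  (λ i i≤ L<i _ → ⊥-elim (ℕP.<-irrefl refl (ℕP.<-≤-trans L<i i≤)))
...   | no W≰ = lastMin a Pa≢0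
  (λ i i≤ Pi≢0 → [ (λ i≤L → min i i≤L Pi≢0) , (λ { refl → ℤP.<⇒≤ (ℤP.≰⇒> W≰) }) ]′ (≤-suc-split i≤))
  (λ i i≤ a<i Pi≢0 → [ (λ i≤L → strict i i≤L a<i Pi≢0) , (λ { refl → ℤP.≰⇒> W≰ }) ]′ (≤-suc-split i≤))

firstMinimiser : ∀ P W L → P 0 ≢ 0ℚ → FirstMinimiser P W L
firstMinimiser P W zero P₀≢0 =
  firstMin 0 P₀≢0 (λ { .zero ℕ.z≤n _ → ℤP.≤-refl }) (λ _ ())
firstMinimiser P W (suc L) P₀≢0 with firstMinimiser P W L P₀≢0 | P (suc L) ℚP.≟ 0ℚ
... | firstMin a Pa≢0 min strict | yes P≡0 = firstMin a Pa≢0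
  (λ i i≤ Pi≢0 → [ (λ i≤L → min i i≤L Pi≢0) , (λ { refl → ⊥-elim (Pi≢0 P≡0) }) ]′ (≤-suc-split i≤)) strict
... | firstMin a Pa≢0 min strict | no P≢0 with W a ℤP.≤? W (suc L)
...   | yes W≤ = firstMin a Pa≢0
  (λ i i≤ Pi≢0 → [ (λ i≤L → min i i≤L Pi≢0) , (λ { refl → W≤ }) ]′ (≤-suc-split i≤)) strict
...   | no W≰ = firstMin (suc L) P≢0
  (λ i i≤ Pi≢0 → [ (λ i≤L → ℤP.≤-trans (ℤP.<⇒≤ (ℤP.≰⇒> W≰)) (min i i≤L Pi≢0)) , (λ { refl → ℤP.≤-refl }) ]′ (≤-suc-split i≤))
  (λ i i<L Pi≢0 → ℤP.<-≤-trans (ℤP.≰⇒> W≰) (min i (ℕP.≤-pred i<L) Pi≢0))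

-- Valuations scaled by k, so that the slope -1/k of the relevant Newton polygon edge becomes
-- integral; the zero coefficient has every lower bound (valuation +∞).
module ScaledValuation (q : ℕ) (p-prime : Prime (suc (suc q))) (k₀ : ℕ) where

  open RationalValuation q p-prime public

  k : ℕ
  k = suc k₀

  K : ℤ
  K = + k

  _kν≥_ : ℚ → ℤ → Set
  x kν≥ M = x ≡ 0ℚ ⊎ (x ≢ 0ℚ × M ℤ.≤ K ℤ.* νℚ x)

  _kν≡_ : ℚ → ℤ → Set
  x kν≡ M = x ≢ 0ℚ × K ℤ.* νℚ x ≡ M

  kν≥-intro : ∀ x M → (x ≢ 0ℚ → M ℤ.≤ K ℤ.* νℚ x) → x kν≥ M
  kν≥-intro x M f with x ℚP.≟ 0ℚ
  ... | yes x≡0 = inj₁ x≡0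
  ... | no x≢0  = inj₂ (x≢0 , f x≢0)

  kν≡⇒kν≥ : ∀ {x M} → x kν≡ M → x kν≥ M
  kν≡⇒kν≥ (x≢0 , e) = inj₂ (x≢0 , ℤP.≤-reflexive (sym e))

  kν≥-weaken : ∀ {x M N} → x kν≥ M → N ℤ.≤ M → x kν≥ N
  kν≥-weaken (inj₁ x≡0)       _   = inj₁ x≡0
  kν≥-weaken (inj₂ (x≢0 , h)) N≤M = inj₂ (x≢0 , ℤP.≤-trans N≤M h)

  K*-mono-≤ : ∀ {a b} → a ℤ.≤ b → K ℤ.* a ℤ.≤ K ℤ.* b
  K*-mono-≤ = ℤP.*-monoˡ-≤-nonNeg K

  K*-cancel-< : ∀ {a b} → K ℤ.* a ℤ.< K ℤ.* b → a ℤ.< b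
  K*-cancel-< = ℤP.*-cancelˡ-<-nonNeg K

  kν≥-+ : ∀ {x y M} → x kν≥ M → y kν≥ M → (x ℚ.+ y) kν≥ M
  kν≥-+ {x} {y} (inj₁ refl) y≥ = subst (_kν≥ _) (sym (ℚP.+-identityˡ y)) y≥
  kν≥-+ {x} {y} (inj₂ x≥) (inj₁ refl) = subst (_kν≥ _) (sym (ℚP.+-identityʳ x)) (inj₂ x≥)
  kν≥-+ {x} {y} (inj₂ (x≢0 , hx)) (inj₂ (y≢0 , hy)) with x ℚ.+ y ℚP.≟ 0ℚ
  ... | yes x+y≡0 = inj₁ x+y≡0
  ... | no x+y≢0 with ℤP.≤-total (νℚ x) (νℚ y)
  ...   | inj₁ νx≤νy = inj₂ (x+y≢0 , ℤP.≤-trans hx (K*-mono-≤ (νℚ-+-≥ x y x≢0 y≢0 x+y≢0 νx≤νy)))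
  ...   | inj₂ νy≤νx = inj₂ (x+y≢0 , ℤP.≤-trans hy (K*-mono-≤ (subst (λ z → νℚ y ℤ.≤ νℚ z) (ℚP.+-comm y x)
                          (νℚ-+-≥ y x y≢0 x≢0 (λ e → x+y≢0 (trans (ℚP.+-comm x y) e)) νy≤νx))))

  kν≡-+ˡ : ∀ {x y M} → x kν≡ M → y kν≥ (1ℤ ℤ.+ M) → (x ℚ.+ y) kν≡ M
  kν≡-+ˡ {x} {y} x≡ (inj₁ refl) = subst (_kν≡ _) (sym (ℚP.+-identityʳ x)) x≡
  kν≡-+ˡ {x} {y} {M} (x≢0 , e) (inj₂ (y≢0 , hy)) = proj₁ sum , trans (cong (K ℤ.*_) (proj₂ sum)) e
    where
    νx<νy : νℚ x ℤ.< νℚ y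
    νx<νy = K*-cancel-< (ℤP.<-≤-trans (subst (ℤ._< 1ℤ ℤ.+ M) (sym e) (ℤP.suc[i]≤j⇒i<j ℤP.≤-refl)) hy)
    sum : (x ℚ.+ y ≢ 0ℚ) × (νℚ (x ℚ.+ y) ≡ νℚ x)
    sum = νℚ-+-exact x y x≢0 y≢0 νx<νy

  kν≡-+ʳ : ∀ {x y M} → x kν≥ (1ℤ ℤ.+ M) → y kν≡ M → (x ℚ.+ y) kν≡ M
  kν≡-+ʳ {x} {y} x≥ y≡ = subst (_kν≡ _) (ℚP.+-comm y x) (kν≡-+ˡ y≡ x≥)

  kν≥-* : ∀ {x y M N} → x kν≥ M → y kν≥ N → (x ℚ.* y) kν≥ (M ℤ.+ N)
  kν≥-* {x} {y} (inj₁ refl) _ = inj₁ (ℚP.*-zeroˡ y)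
  kν≥-* {x} {y} (inj₂ _) (inj₁ refl) = inj₁ (ℚP.*-zeroʳ x)
  kν≥-* {x} {y} (inj₂ (x≢0 , hx)) (inj₂ (y≢0 , hy)) =
    inj₂ (proj₁ prod , subst (_ ℤ.≤_) (trans (sym (ℤP.*-distribˡ-+ K (νℚ x) (νℚ y))) (cong (K ℤ.*_) (sym (proj₂ prod))))
                                      (ℤP.+-mono-≤ hx hy))
    where
    prod : (x ℚ.* y ≢ 0ℚ) × (νℚ (x ℚ.* y) ≡ νℚ x ℤ.+ νℚ y)
    prod = νℚ-* x y x≢0 y≢0

  kν≡-* : ∀ {x y M N} → x kν≡ M → y kν≡ N → (x ℚ.* y) kν≡ (M ℤ.+ N)
  kν≡-* {x} {y} (x≢0 , hx) (y≢0 , hy) =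
    proj₁ prod , trans (cong (K ℤ.*_) (proj₂ prod)) (trans (ℤP.*-distribˡ-+ K (νℚ x) (νℚ y)) (cong₂ ℤ._+_ hx hy))
    where
    prod : (x ℚ.* y ≢ 0ℚ) × (νℚ (x ℚ.* y) ≡ νℚ x ℤ.+ νℚ y)
    prod = νℚ-* x y x≢0 y≢0

  kν≥-sum : ∀ m (t : ℕ → ℚ) M → (∀ i → i ℕ.≤ m → t i kν≥ M) → sumℚ m t kν≥ M
  kν≥-sum zero    t M h = h 0 ℕ.z≤n
  kν≥-sum (suc m) t M h = kν≥-+ (kν≥-sum m t M (λ i i≤m → h i (ℕP.m≤n⇒m≤1+n i≤m))) (h (suc m) ℕP.≤-refl)

  kν≡-sum : ∀ m (t : ℕ → ℚ) M i₀ → i₀ ℕ.≤ m → t i₀ kν≡ M →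
            (∀ i → i ℕ.≤ m → i ≢ i₀ → t i kν≥ (1ℤ ℤ.+ M)) → sumℚ m t kν≡ M
  kν≡-sum zero t M .zero ℕ.z≤n t₀≡ _ = t₀≡
  kν≡-sum (suc m) t M i₀ i₀≤ t₀≡ others with i₀ ℕ.≟ suc m
  ... | yes refl = kν≡-+ʳ (kν≥-sum m t _ (λ i i≤m → others i (ℕP.m≤n⇒m≤1+n i≤m) (ℕP.<⇒≢ (ℕ.s≤s i≤m)))) t₀≡
  ... | no i₀≢ = kν≡-+ˡ (kν≡-sum m t M i₀ (ℕP.≤-pred (ℕP.≤∧≢⇒< i₀≤ i₀≢)) t₀≡
                           (λ i i≤m → others i (ℕP.m≤n⇒m≤1+n i≤m)))
                        (others (suc m) ℕP.≤-refl (λ e → i₀≢ (sym e)))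

module NewtonPolygon (q : ℕ) (p-prime : Prime (suc (suc q))) (k₀ : ℕ) where

  open ScaledValuation q p-prime k₀ public
  open NatDifference
  open +-*-Solver

  module Factorisation (f : Poly) (n : ℕ) (f-vanishes : ∀ i → n ℕ.< i → coeff f i ≡ 0ℚ)
                       (c₀≢0 : coeff f 0 ≢ 0ℚ) (g h : Poly) (deg-g : HasDegree g k)
                       (g*h≡f : ∀ m → mulCoeff g h m ≡ coeff f m) where

    G H c : ℕ → ℚ
    G = coeff g
    H = coeff h
    c = coeff f

    term : ℕ → ℕ → ℚ
    term t i = G i ℚ.* H (t ℕ.∸ i)

    g-support : ∀ i → G i ≢ 0ℚ → i ℕ.≤ k
    g-support i Gi≢0 with i ℕ.≤? k
    ... | yes i≤k = i≤k
    ... | no i≰k  = ⊥-elim (Gi≢0 (coeff-beyond-length g i (subst (ℕ._≤ i) (sym (proj₁ deg-g)) (ℕP.≰⇒> i≰k))))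

    h-support : ∀ i → H i ≢ 0ℚ → i ℕ.≤ length h
    h-support i Hi≢0 with i ℕ.≤? length h
    ... | yes i≤ = i≤
    ... | no i≰  = ⊥-elim (Hi≢0 (coeff-beyond-length h i (ℕP.<⇒≤ (ℕP.≰⇒> i≰))))

    f-support : ∀ t → c t ≢ 0ℚ → t ℕ.≤ n
    f-support t ct≢0 with t ℕ.≤? n
    ... | yes t≤n = t≤n
    ... | no t≰n  = ⊥-elim (ct≢0 (f-vanishes t (ℕP.≰⇒> t≰n)))

    *≢0ˡ : ∀ x y → x ℚ.* y ≢ 0ℚ → x ≢ 0ℚ
    *≢0ˡ x y h refl = h (ℚP.*-zeroˡ y)

    *≢0ʳ : ∀ x y → x ℚ.* y ≢ 0ℚ → y ≢ 0ℚ
    *≢0ʳ x y h refl = h (ℚP.*-zeroʳ x)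

    G₀≢0 : G 0 ≢ 0ℚ
    G₀≢0 = *≢0ˡ (G 0) (H 0) (subst (_≢ 0ℚ) (sym (g*h≡f 0)) c₀≢0)

    H₀≢0 : H 0 ≢ 0ℚ
    H₀≢0 = *≢0ʳ (G 0) (H 0) (subst (_≢ 0ℚ) (sym (g*h≡f 0)) c₀≢0)

    term≡0ˡ : ∀ t i → G i ≡ 0ℚ → term t i ≡ 0ℚ
    term≡0ˡ t i e = trans (cong (ℚ._* H (t ℕ.∸ i)) e) (ℚP.*-zeroˡ (H (t ℕ.∸ i)))

    term≡0ʳ : ∀ t i → H (t ℕ.∸ i) ≡ 0ℚ → term t i ≡ 0ℚ
    term≡0ʳ t i e = trans (cong (G i ℚ.*_) e) (ℚP.*-zeroʳ (G i))

    coeff-kν≡ : ∀ t a M → a ℕ.≤ t → term t a kν≡ M →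
                (∀ i → i ℕ.≤ t → i ≢ a → term t i kν≥ (1ℤ ℤ.+ M)) → c t kν≡ M
    coeff-kν≡ t a M a≤t dominant others = subst (_kν≡ M) (g*h≡f t) (kν≡-sum t (term t) M a a≤t dominant others)

    -- The last minimisers of k ν Gᵢ + i and k ν Hⱼ + j are the rightmost points where a line of slope
    -- −1/k supports the two Newton polygons; at the sum t of these indices exactly one term of the
    -- coefficient of f attains the minimal weight.
    WG WH : ℕ → ℤ
    WG i = K ℤ.* νℚ (G i) ℤ.+ + i
    WH i = K ℤ.* νℚ (H i) ℤ.+ + i

    module lastMinG = LastMinimiser (lastMinimiser G WG k G₀≢0)
    module lastMinH = LastMinimiser (lastMinimiser H WH (length h) H₀≢0)

    WG-minimal : ∀ i → G i ≢ 0ℚ → WG lastMinG.index ℤ.≤ WG i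
    WG-minimal i Gi≢0 = lastMinG.minimal i (g-support i Gi≢0) Gi≢0

    WH-minimal : ∀ i → H i ≢ 0ℚ → WH lastMinH.index ℤ.≤ WH i
    WH-minimal i Hi≢0 = lastMinH.minimal i (h-support i Hi≢0) Hi≢0

    t : ℕ
    t = lastMinG.index ℕ.+ lastMinH.index

    M : ℤ
    M = WG lastMinG.index ℤ.+ WH lastMinH.index

    term-kν≡ : ∀ i → i ℕ.≤ t → G i ≢ 0ℚ → H (t ℕ.∸ i) ≢ 0ℚ →
               term t i kν≡ (WG i ℤ.+ WH (t ℕ.∸ i) ℤ.- + t)
    term-kν≡ i i≤t Gi≢0 Hj≢0 =
      subst (term t i kν≡_) (trans (weights (K ℤ.* νℚ (G i)) (K ℤ.* νℚ (H (t ℕ.∸ i))) i (t ℕ.∸ i))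
                                   (cong (λ z → WG i ℤ.+ WH (t ℕ.∸ i) ℤ.- + z) (ℕP.m+[n∸m]≡n i≤t)))
        (kν≡-* (Gi≢0 , refl) (Hj≢0 , refl))
      where
      weights : ∀ x y i j → x ℤ.+ y ≡ ((x ℤ.+ + i) ℤ.+ (y ℤ.+ + j)) ℤ.- + (i ℕ.+ j)
      weights x y i j rewrite ℤP.pos-+ i j =
        solve 4 (λ x y i j → x :+ y := ((x :+ i) :+ (y :+ j)) :- (i :+ j)) refl x y (+ i) (+ j)

    other-weight-larger : ∀ i → i ℕ.≤ t → i ≢ lastMinG.index → G i ≢ 0ℚ → H (t ℕ.∸ i) ≢ 0ℚ →
                          M ℤ.< WG i ℤ.+ WH (t ℕ.∸ i)
    other-weight-larger i i≤t i≢a Gi≢0 Hj≢0 with ℕP.<-cmp lastMinG.index i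
    ... | tri< a<i _ _ = ℤP.+-mono-<-≤ (lastMinG.strict i (g-support i Gi≢0) a<i Gi≢0) (WH-minimal j Hj≢0)
      where j = t ℕ.∸ i
    ... | tri≈ _ a≡i _ = ⊥-elim (i≢a (sym a≡i))
    ... | tri> _ _ i<a = ℤP.+-mono-≤-< (WG-minimal i Gi≢0) (lastMinH.strict j (h-support j Hj≢0) b<j Hj≢0)
      where
      j = t ℕ.∸ i
      b<j : lastMinH.index ℕ.< j
      b<j = ℕP.+-cancelˡ-< i lastMinH.index j
              (subst (i ℕ.+ lastMinH.index ℕ.<_) (sym (ℕP.m+[n∸m]≡n i≤t)) (ℕP.+-monoˡ-< lastMinH.index i<a))

    last-vertex : c t kν≡ (M ℤ.- + t)
    last-vertex = coeff-kν≡ t lastMinG.index (M ℤ.- + t) (ℕP.m≤m+n lastMinG.index lastMinH.index) dominant others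
      where
      dominant : term t lastMinG.index kν≡ (M ℤ.- + t)
      dominant = subst (λ j → term t lastMinG.index kν≡ (WG lastMinG.index ℤ.+ WH j ℤ.- + t)) (ℕP.m+n∸m≡n lastMinG.index lastMinH.index)
                   (term-kν≡ lastMinG.index (ℕP.m≤m+n lastMinG.index lastMinH.index) lastMinG.nonzero
                     (subst (λ j → H j ≢ 0ℚ) (sym (ℕP.m+n∸m≡n lastMinG.index lastMinH.index)) lastMinH.nonzero))
      others : ∀ i → i ℕ.≤ t → i ≢ lastMinG.index → term t i kν≥ (1ℤ ℤ.+ (M ℤ.- + t))
      others i i≤t i≢a with G i ℚP.≟ 0ℚ | H (t ℕ.∸ i) ℚP.≟ 0ℚ
      ... | yes Gi≡0 | _         = inj₁ (term≡0ˡ t i Gi≡0)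
      ... | no _     | yes Hj≡0  = inj₁ (term≡0ʳ t i Hj≡0)
      ... | no Gi≢0  | no Hj≢0   = kν≥-weaken (kν≡⇒kν≥ (term-kν≡ i i≤t Gi≢0 Hj≢0))
                                     (<⇒1+diff≤ M _ (+ t) (other-weight-larger i i≤t i≢a Gi≢0 Hj≢0))

    constant-bound : M ℤ.≤ K ℤ.* νℚ (c 0)
    constant-bound = subst (M ℤ.≤_) (sym (trans (cong (λ z → K ℤ.* νℚ z) (sym (g*h≡f 0))) (proj₂ c₀≡)))
                       (subst (M ℤ.≤_) (cong₂ ℤ._+_ (ℤP.+-identityʳ (K ℤ.* νℚ (G 0))) (ℤP.+-identityʳ (K ℤ.* νℚ (H 0))))
                         (ℤP.+-mono-≤ (WG-minimal 0 G₀≢0) (WH-minimal 0 H₀≢0)))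
      where
      c₀≡ : (G 0 ℚ.* H 0) kν≡ (K ℤ.* νℚ (G 0) ℤ.+ K ℤ.* νℚ (H 0))
      c₀≡ = kν≡-* (G₀≢0 , refl) (H₀≢0 , refl)

    module _ (below-line : ∀ i → 1 ℕ.≤ i → i ℕ.≤ n → c i ≢ 0ℚ → K ℤ.* νℚ (c 0) ℤ.< K ℤ.* νℚ (c i) ℤ.+ + i) where

      vertex-at-origin : t ≡ 0
      vertex-at-origin with t ℕ.≟ 0
      ... | yes t≡0 = t≡0
      ... | no t≢0  = ⊥-elim (ℤP.<-irrefl refl (ℤP.≤-<-trans constant-bound (subst (K ℤ.* νℚ (c 0) ℤ.<_) weight≡M below)))
        where
        below : K ℤ.* νℚ (c 0) ℤ.< K ℤ.* νℚ (c t) ℤ.+ + t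
        below = below-line t (ℕP.n≢0⇒n>0 t≢0) (f-support t (proj₁ last-vertex)) (proj₁ last-vertex)
        weight≡M : K ℤ.* νℚ (c t) ℤ.+ + t ≡ M
        weight≡M = trans (cong (ℤ._+ + t) (proj₂ last-vertex)) (solve 2 (λ M t → (M :- t) :+ t := M) refl M (+ t))

      νG-minimal-at-0 : ∀ i → G i ≢ 0ℚ → νℚ (G 0) ℤ.≤ νℚ (G i)
      νG-minimal-at-0 zero    _     = ℤP.≤-refl
      νG-minimal-at-0 (suc i) Gi≢0 = <1+⇒≤ (K*-cancel-< (ℤP.<-≤-trans WG₀<K[νGᵢ]+K (ℤP.≤-reflexive distrib)))
        where
        index≡0 : lastMinG.index ≡ 0
        index≡0 = ℕP.m+n≡0⇒m≡0 lastMinG.index vertex-at-origin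
        WG₀<WGᵢ : WG 0 ℤ.< WG (suc i)
        WG₀<WGᵢ = subst (λ z → WG z ℤ.< WG (suc i)) index≡0
                    (lastMinG.strict (suc i) (g-support (suc i) Gi≢0) (subst (ℕ._< suc i) (sym index≡0) (ℕ.s≤s ℕ.z≤n)) Gi≢0)
        WG₀<K[νGᵢ]+K : K ℤ.* νℚ (G 0) ℤ.< K ℤ.* νℚ (G (suc i)) ℤ.+ K
        WG₀<K[νGᵢ]+K = ℤP.<-≤-trans (subst (ℤ._< WG (suc i)) (ℤP.+-identityʳ _) WG₀<WGᵢ)
                         (ℤP.+-monoʳ-≤ (K ℤ.* νℚ (G (suc i))) (ℤ.+≤+ (g-support (suc i) Gi≢0)))
        distrib : K ℤ.* νℚ (G (suc i)) ℤ.+ K ≡ K ℤ.* (1ℤ ℤ.+ νℚ (G (suc i)))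
        distrib = solve 2 (λ k y → k :* y :+ k := k :* (con 1ℤ :+ y)) refl K (νℚ (G (suc i)))

    -- With ν G minimal at 0, the first index where ν H is minimal lies in [0, n - k], and the
    -- coefficient of f there has valuation no larger than that of the leading coefficient.
    -- For a constant weight, the last minimiser is the last nonzero coefficient: the degree of h.
    module deg-h = LastMinimiser (lastMinimiser H (λ _ → ℤ.0ℤ) (length h) H₀≢0)

    H-vanishes : ∀ i → deg-h.index ℕ.< i → H i ≡ 0ℚ
    H-vanishes i d<i with H i ℚP.≟ 0ℚ
    ... | yes Hi≡0 = Hi≡0
    ... | no Hi≢0  = ⊥-elim (ℤP.<-irrefl refl (deg-h.strict i (h-support i Hi≢0) d<i Hi≢0))

    k+deg-h≤n : k ℕ.+ deg-h.index ℕ.≤ n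
    k+deg-h≤n = f-support (k ℕ.+ d) (subst (_≢ 0ℚ) (sym leading)
                  (proj₁ (νℚ-* (G k) (H d) (proj₂ deg-g) deg-h.nonzero)))
      where
      d = deg-h.index
      leading : c (k ℕ.+ d) ≡ G k ℚ.* H d
      leading = trans (sym (g*h≡f (k ℕ.+ d)))
                  (trans (sumℚ-single (k ℕ.+ d) (term (k ℕ.+ d)) k (ℕP.m≤m+n k d) vanish)
                         (cong (λ z → G k ℚ.* H z) (ℕP.m+n∸m≡n k d)))
        where
        vanish : ∀ i → i ℕ.≤ k ℕ.+ d → i ≢ k → term (k ℕ.+ d) i ≡ 0ℚ
        vanish i _ i≢k with ℕP.<-cmp i k
        ... | tri< i<k _ _ = term≡0ʳ (k ℕ.+ d) i (H-vanishes (k ℕ.+ d ℕ.∸ i)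
                               (ℕP.m+n≤o⇒m≤o∸n (suc d) (subst (ℕ._≤ k ℕ.+ d) (cong suc (ℕP.+-comm i d))
                                 (ℕP.+-monoˡ-≤ d i<k))))
        ... | tri≈ _ i≡k _ = ⊥-elim (i≢k i≡k)
        ... | tri> _ _ k<i = term≡0ˡ (k ℕ.+ d) i (coeff-beyond-length g i (subst (ℕ._≤ i) (sym (proj₁ deg-g)) k<i))

    module firstMinH = FirstMinimiser (firstMinimiser H (λ i → K ℤ.* νℚ (H i)) (length h) H₀≢0)

    first-min≤n∸k : firstMinH.index ℕ.≤ n ℕ.∸ k
    first-min≤n∸k = ℕP.m+n≤o⇒m≤o∸n firstMinH.index
      (ℕP.≤-trans (ℕP.+-monoˡ-≤ k index≤d) (subst (ℕ._≤ n) (ℕP.+-comm k deg-h.index) k+deg-h≤n))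
      where
      index≤d : firstMinH.index ℕ.≤ deg-h.index
      index≤d with firstMinH.index ℕ.≤? deg-h.index
      ... | yes i≤d = i≤d
      ... | no i≰d  = ⊥-elim (firstMinH.nonzero (H-vanishes firstMinH.index (ℕP.≰⇒> i≰d)))

    module _ (νG-minimal-at-0 : ∀ i → G i ≢ 0ℚ → νℚ (G 0) ℤ.≤ νℚ (G i)) where

      M′ : ℤ
      M′ = K ℤ.* νℚ (G 0) ℤ.+ K ℤ.* νℚ (H firstMinH.index)

      G-kν≥ : ∀ i → G i kν≥ (K ℤ.* νℚ (G 0))
      G-kν≥ i = kν≥-intro (G i) _ (λ Gi≢0 → K*-mono-≤ (νG-minimal-at-0 i Gi≢0))

      first-vertex : c firstMinH.index kν≡ M′
      first-vertex = coeff-kν≡ firstMinH.index 0 M′ ℕ.z≤n (kν≡-* (G₀≢0 , refl) (firstMinH.nonzero , refl)) others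
        where
        others : ∀ i → i ℕ.≤ firstMinH.index → i ≢ 0 → term firstMinH.index i kν≥ (1ℤ ℤ.+ M′)
        others i i≤ i≢0 = kν≥-weaken (kν≥-* (G-kν≥ i) (kν≥-intro (H j) _ λ Hj≢0 → ℤP.i<j⇒suc[i]≤j (firstMinH.strict j j< Hj≢0)))
                            (ℤP.≤-reflexive (solve 2 (λ x y → con 1ℤ :+ (x :+ y) := x :+ (con 1ℤ :+ y)) refl
                               (K ℤ.* νℚ (G 0)) (K ℤ.* νℚ (H firstMinH.index))))
          where
          j = firstMinH.index ℕ.∸ i
          j< : j ℕ.< firstMinH.index
          j< = ℕP.∸-monoʳ-< {firstMinH.index} {i} {0} (ℕP.n≢0⇒n>0 i≢0) i≤

      leading-kν≥ : c n kν≥ M′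
      leading-kν≥ = subst (_kν≥ M′) (g*h≡f n) (kν≥-sum n (term n) M′ (λ i _ → kν≥-* (G-kν≥ i)
                      (kν≥-intro (H (n ℕ.∸ i)) _ (λ Hj≢0 → firstMinH.minimal (n ℕ.∸ i) (h-support _ Hj≢0) Hj≢0))))

  no-factor-of-degree : (f : Poly) (n : ℕ) (c : ℕ → ℚ) → (∀ i → i ℕ.≤ n → coeff f i ≡ c i) →
    (∀ i → n ℕ.< i → coeff f i ≡ 0ℚ) → c 0 ≢ 0ℚ → c n ≢ 0ℚ →
    (∀ i → i ℕ.≤ n ℕ.∸ k → c i ≢ 0ℚ → νℚ (c n) ℤ.< νℚ (c i)) →
    (∀ i → 1 ℕ.≤ i → i ℕ.≤ n → c i ≢ 0ℚ → K ℤ.* νℚ (c 0) ℤ.< K ℤ.* νℚ (c i) ℤ.+ + i) →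
    ¬ HasFactorOfDegree f k
  no-factor-of-degree f n c coeff-f f-vanishes c₀≢0 cₙ≢0 top-dominates below-line (g , h , deg-g , g*h≡f) =
    [ (λ fₙ≡0 → cₙ≢0 (trans (sym (coeff-f n ℕP.≤-refl)) fₙ≡0))
    , (λ (_ , M′≤kνfₙ) → ℤP.<⇒≱ (top-dominates′ firstMinH.index first-min≤n∸k (proj₁ vertex))
         (ℤP.*-cancelˡ-≤-pos _ _ K (subst (ℤ._≤ K ℤ.* νℚ (coeff f n)) (sym (proj₂ vertex)) M′≤kνfₙ))) ]′
      (leading-kν≥ νG-minimal)
    where
    f₀≢0 : coeff f 0 ≢ 0ℚ
    f₀≢0 = subst (_≢ 0ℚ) (sym (coeff-f 0 ℕ.z≤n)) c₀≢0
    open Factorisation f n f-vanishes f₀≢0 g h deg-g g*h≡f hiding (c)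
    i≤n : ∀ {i} → i ℕ.≤ n ℕ.∸ k → i ℕ.≤ n
    i≤n i≤n-k = ℕP.≤-trans i≤n-k (ℕP.m∸n≤m n k)
    top-dominates′ : ∀ i → i ℕ.≤ n ℕ.∸ k → coeff f i ≢ 0ℚ → νℚ (coeff f n) ℤ.< νℚ (coeff f i)
    top-dominates′ i i≤n-k fᵢ≢0 = subst₂ (λ u w → νℚ u ℤ.< νℚ w) (sym (coeff-f n ℕP.≤-refl)) (sym (coeff-f i (i≤n i≤n-k)))
                                   (top-dominates i i≤n-k (subst (_≢ 0ℚ) (coeff-f i (i≤n i≤n-k)) fᵢ≢0))
    below-line′ : ∀ i → 1 ℕ.≤ i → i ℕ.≤ n → coeff f i ≢ 0ℚ → K ℤ.* νℚ (coeff f 0) ℤ.< K ℤ.* νℚ (coeff f i) ℤ.+ + i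
    below-line′ i 1≤i i≤n fᵢ≢0 = subst₂ (λ u w → K ℤ.* νℚ u ℤ.< K ℤ.* νℚ w ℤ.+ + i) (sym (coeff-f 0 ℕ.z≤n)) (sym (coeff-f i i≤n))
                                  (below-line i 1≤i i≤n (subst (_≢ 0ℚ) (coeff-f i i≤n) fᵢ≢0))
    νG-minimal : ∀ i → coeff g i ≢ 0ℚ → νℚ (coeff g 0) ℤ.≤ νℚ (coeff g i)
    νG-minimal = νG-minimal-at-0 below-line′
    vertex : coeff f firstMinH.index kν≡ M′ νG-minimal
    vertex = first-vertex νG-minimal

module Products where

  open import Data.Nat
  open import Data.Nat.Properties
  open import Data.Nat.Divisibility
  open import Data.Nat.Primality using (prime⇒nonTrivial)

  _↑_ : ℕ → ℕ → ℕ
  a ↑ m = prodℕ m (λ t → a + t)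

  prodℕ-cong : ∀ m f g → (∀ t → 1 ≤ t → t ≤ m → f t ≡ g t) → prodℕ m f ≡ prodℕ m g
  prodℕ-cong zero    f g f≗g = refl
  prodℕ-cong (suc m) f g f≗g =
    cong₂ _*_ (prodℕ-cong m f g (λ t 1≤t t≤m → f≗g t 1≤t (m≤n⇒m≤1+n t≤m))) (f≗g (suc m) (s≤s z≤n) ≤-refl)

  prodℕ-+ : ∀ m l f → prodℕ (m + l) f ≡ prodℕ m f * prodℕ l (λ t → f (m + t))
  prodℕ-+ m zero    f rewrite +-identityʳ m = sym (*-identityʳ _)
  prodℕ-+ m (suc l) f rewrite +-suc m l | prodℕ-+ m l f = *-assoc (prodℕ m f) _ _

  prodℕ≢0 : ∀ m f → (∀ t → 1 ≤ t → t ≤ m → f t ≢ 0) → prodℕ m f ≢ 0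
  prodℕ≢0 zero    f f≢0 ()
  prodℕ≢0 (suc m) f f≢0 e with m*n≡0⇒m≡0∨n≡0 (prodℕ m f) e
  ... | inj₁ h = prodℕ≢0 m f (λ t 1≤t t≤m → f≢0 t 1≤t (m≤n⇒m≤1+n t≤m)) h
  ... | inj₂ h = f≢0 (suc m) (s≤s z≤n) ≤-refl h

  ∣prodℕ : ∀ m f t → 1 ≤ t → t ≤ m → f t ∣ prodℕ m f
  ∣prodℕ zero    f (suc t) _ ()
  ∣prodℕ (suc m) f t 1≤t t≤ with t ≟ suc m
  ... | yes refl = n∣m*n (prodℕ m f)
  ... | no t≢    = ∣m⇒∣m*n (f (suc m)) (∣prodℕ m f t 1≤t (≤-pred (≤∧≢⇒< t≤ t≢)))

  prime∣prodℕ : ∀ {p} → Prime p → ∀ m f → p ∣ prodℕ m f → Σ ℕ λ t → (1 ≤ t) × (t ≤ m) × (p ∣ f t)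
  prime∣prodℕ {p} p-prime zero f d = ⊥-elim (nonTrivial⇒≢1 {{prime⇒nonTrivial p-prime}} (∣1⇒≡1 d))
  prime∣prodℕ p-prime (suc m) f d with euclidsLemma (prodℕ m f) (f (suc m)) p-prime d
  ... | inj₂ p∣f = suc m , s≤s z≤n , ≤-refl , p∣f
  ... | inj₁ p∣prod with prime∣prodℕ p-prime m f p∣prod
  ...   | t , 1≤t , t≤m , p∣f = t , 1≤t , m≤n⇒m≤1+n t≤m , p∣f

  ↑≢0 : ∀ a m → a ↑ m ≢ 0
  ↑≢0 a m = prodℕ≢0 m (λ t → a + t) λ { (suc t) _ _ e → 1+n≢0 (trans (sym (+-suc a t)) e) }

  !≡0↑ : ∀ n → n ! ≡ 0 ↑ n
  !≡0↑ zero    = refl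
  !≡0↑ (suc n) = trans (*-comm (suc n) (n !)) (cong (_* suc n) (!≡0↑ n))

  !-split : ∀ x m → (x + m) ! ≡ x ! * x ↑ m
  !-split x m = trans (!≡0↑ (x + m)) (trans (prodℕ-+ x m (λ t → t)) (cong (_* x ↑ m) (sym (!≡0↑ x))))

  n!≢0 : ∀ n → n ! ≢ 0
  n!≢0 n = ≢-nonZero⁻¹ (n !) {{n !≢0}}

module Inequalities where

  open import Data.Nat
  open import Data.Nat.Properties
  open import Data.Nat.Tactic.RingSolver using (solve-∀)

  private
    ≤⇒+ : ∀ {m n} → m ≤ n → Σ ℕ λ d → n ≡ m + d
    ≤⇒+ {m} {n} m≤n = n ∸ m , sym (m+[n∸m]≡n m≤n)

  quotient-small : ∀ P a k A → A * P ≤ a → 1 ≤ k → k + 2 ≤ P →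
                   (2 * a ≤ P * k) ⊎ (k * k + a ≤ P * k) → 2 * A + 1 ≤ P
  quotient-small P a k A AP≤a 1≤k k+2≤P (inj₁ 2a≤Pk) =
    ≤-trans (+-monoˡ-≤ 1 2A≤k) (≤-trans (+-monoʳ-≤ k (s≤s z≤n)) k+2≤P)
    where
    2A≤k : 2 * A ≤ k
    2A≤k = *-cancelʳ-≤ (2 * A) k P {{>-nonZero (≤-trans (s≤s z≤n) (≤-trans (m≤n+m 2 k) k+2≤P))}} (begin
      2 * A * P   ≡⟨ *-assoc 2 A P ⟩
      2 * (A * P) ≤⟨ *-monoʳ-≤ 2 AP≤a ⟩
      2 * a       ≤⟨ 2a≤Pk ⟩
      P * k       ≡⟨ *-comm P k ⟩
      k * P       ∎)
      where open ≤-Reasoning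
  quotient-small P a k A AP≤a 1≤k k+2≤P (inj₂ k²+a≤Pk) with 2 * A + 1 ≤? P
  ... | yes 2A+1≤P = 2A+1≤P
  ... | no 2A+1≰P  with ≤⇒+ (≤-trans (m≤m+n k 2) k+2≤P)
  ...   | d , refl = ⊥-elim (<-irrefl refl (<-≤-trans big small))
    where
    -- 2Pk < 2k² + P² ≤ 2k² + 2AP ≤ 2Pk, since P² - 2Pk + 2k² = (P-k)² + k² > 0.
    P≤2A : P ≤ 2 * A
    P≤2A = ≤-pred (subst (suc P ≤_) (+-comm (2 * A) 1) (≰⇒> 2A+1≰P))
    small : 2 * (k * k) + P * P ≤ 2 * (P * k)
    small = begin
      2 * (k * k) + P * P       ≤⟨ +-monoʳ-≤ (2 * (k * k)) (*-monoˡ-≤ P P≤2A) ⟩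
      2 * (k * k) + 2 * A * P   ≡⟨ cong (λ z → 2 * (k * k) + z) (*-assoc 2 A P) ⟩
      2 * (k * k) + 2 * (A * P) ≡⟨ sym (*-distribˡ-+ 2 (k * k) (A * P)) ⟩
      2 * (k * k + A * P)       ≤⟨ *-monoʳ-≤ 2 (≤-trans (+-monoʳ-≤ (k * k) AP≤a) k²+a≤Pk) ⟩
      2 * (P * k)               ∎
      where open ≤-Reasoning
    expand : ∀ k d → 2 * (k * k) + (k + d) * (k + d) ≡ 2 * ((k + d) * k) + (k * k + d * d)
    expand = solve-∀
    big : 2 * (P * k) < 2 * (k * k) + P * P
    big = begin-strict
      2 * (P * k)                   <⟨ m<m+n (2 * (P * k)) (≤-trans (*-mono-≤ 1≤k 1≤k) (m≤m+n (k * k) (d * d))) ⟩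
      2 * (P * k) + (k * k + d * d) ≡⟨ sym (expand k d) ⟩
      2 * (k * k) + P * P           ∎
      where open ≤-Reasoning

  bound-without-S : ∀ P k r M → 1 ≤ M → k + suc r ≤ P → k * M + r < P * M
  bound-without-S P k r M 1≤M k+r<P with ≤⇒+ k+r<P
  ... | d , refl = begin-strict
    k * M + r               <⟨ +-monoʳ-< (k * M) (n<1+n r) ⟩
    k * M + suc r           ≤⟨ +-monoʳ-≤ (k * M) (≤-trans (m≤m+n (suc r) d) (m≤m*n (suc r + d) M {{>-nonZero 1≤M}})) ⟩
    k * M + (suc r + d) * M ≡⟨ sym (expand k r d M) ⟩
    (k + suc r + d) * M     ∎
    where
    open ≤-Reasoning
    expand : ∀ k r d M → (k + suc r + d) * M ≡ k * M + (suc r + d) * M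
    expand = solve-∀

  bound-small-quotient : ∀ P k r A M S → k + suc r ≤ P → k + 2 ≤ P → 2 * A + 1 ≤ P → P ≤ A + M →
                         k * S + 1 ≤ A + M → k * (M + S) + r < P * M
  bound-small-quotient P k r A M S k+r<P k+2≤P 2A+1≤P P≤A+M kS<A+M with ≤⇒+ k+r<P
  ... | d , refl = begin
    suc (k * (M + S) + r)     ≡⟨ expand₁ k M S r ⟩
    k * M + ((k * S + 1) + r) ≤⟨ +-monoʳ-≤ (k * M) (+-monoˡ-≤ r kS<A+M) ⟩
    k * M + ((A + M) + r)     ≡⟨ cong (λ z → k * M + z) (trans (cong (_+ r) (+-comm A M)) (+-assoc M A r)) ⟩
    k * M + (M + (A + r))     ≤⟨ +-monoʳ-≤ (k * M) (+-monoʳ-≤ M A+r≤uM) ⟩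
    k * M + (M + u * M)       ≡⟨ sym (expand₂ k r d M) ⟩
    (k + suc r + d) * M       ∎
    where
    open ≤-Reasoning
    u = r + d
    expand₁ : ∀ k M S r → suc (k * (M + S) + r) ≡ k * M + ((k * S + 1) + r)
    expand₁ = solve-∀
    expand₂ : ∀ k r d M → (k + suc r + d) * M ≡ k * M + (M + (r + d) * M)
    expand₂ = solve-∀
    1≤u : 1 ≤ u
    1≤u = ≤-pred (+-cancelˡ-≤ k 2 (suc u) (subst (k + 2 ≤_) (+-assoc k (suc r) d) k+2≤P))
    A+1≤M : A + 1 ≤ M
    A+1≤M = +-cancelˡ-≤ A (A + 1) M (subst (_≤ A + M) (double A) (≤-trans 2A+1≤P P≤A+M))
      where double : ∀ A → 2 * A + 1 ≡ A + (A + 1)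
            double = solve-∀
    A+r≤uM : A + r ≤ u * M
    A+r≤uM = begin
      A + r       ≤⟨ +-mono-≤ (m≤n*m A u {{>-nonZero 1≤u}}) (m≤m+n r d) ⟩
      u * A + u   ≡⟨ sym (*-suc′ u A) ⟩
      u * (A + 1) ≤⟨ *-monoʳ-≤ u A+1≤M ⟩
      u * M       ∎
      where *-suc′ : ∀ u A → u * (A + 1) ≡ u * A + u
            *-suc′ = solve-∀

  bound-S≤M : ∀ P k M S → 1 ≤ M → 2 * k < P → S ≤ M → k * (M + S) < P * M
  bound-S≤M P k M S 1≤M 2k<P S≤M = begin-strict
    k * (M + S) ≤⟨ *-monoʳ-≤ k (+-monoʳ-≤ M S≤M) ⟩
    k * (M + M) ≡⟨ double k M ⟩
    2 * k * M   <⟨ *-monoˡ-< M {{>-nonZero 1≤M}} 2k<P ⟩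
    P * M       ∎
    where
    open ≤-Reasoning
    double : ∀ k M → k * (M + M) ≡ 2 * k * M
    double = solve-∀

  bound-S<M : ∀ P k r m S → 2 * k < P → k + suc r ≤ P → S ≤ m → k * (suc m + S) + r < P * suc m
  bound-S<M P k r m S 2k<P k+r<P S≤m with ≤⇒+ 2k<P
  ... | w , refl = begin-strict
    k * (suc m + S) + r                  ≤⟨ +-mono-≤ (*-monoʳ-≤ k (+-monoʳ-≤ (suc m) S≤m)) r≤k+w ⟩
    k * (suc m + m) + (k + w)            ≡⟨ expand₁ k m w ⟩
    2 * k * suc m + w                    <⟨ +-monoʳ-< (2 * k * suc m) (s≤s (m≤m+n w _)) ⟩
    2 * k * suc m + suc (w + (w * m + m)) ≡⟨ sym (expand₂ k w m) ⟩
    (suc (2 * k) + w) * suc m            ∎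
    where
    open ≤-Reasoning
    expand₁ : ∀ k m w → k * (suc m + m) + (k + w) ≡ 2 * k * suc m + w
    expand₁ = solve-∀
    expand₂ : ∀ k w m → (suc (2 * k) + w) * suc m ≡ 2 * k * suc m + suc (w + (w * m + m))
    expand₂ = solve-∀
    r≤k+w : r ≤ k + w
    r≤k+w = ≤-pred (+-cancelˡ-≤ k (suc r) (suc (k + w)) (subst (k + suc r ≤_) (rearrange k w) k+r<P))
      where rearrange : ∀ k w → suc (2 * k) + w ≡ k + suc (k + w)
            rearrange = solve-∀

-- SizeCond with the rationals cleared: p ≥ min (2a/k, k + a/k) becomes 2a ≤ pk or k² + a ≤ pk.
SizeCondℕ : ℕ → ℕ → ℕ → Set
SizeCondℕ p a k = ((2 ℕ.* a ℕ.≤ p ℕ.* k) ⊎ (k ℕ.* k ℕ.+ a ℕ.≤ p ℕ.* k)) ⊎ ((2 ℕ.* k ℕ.< p) × (a ℕ.≤ p ℕ.* p ℕ.∸ p))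

module RisingValuation (q : ℕ) (p-prime : Prime (suc (suc q))) where

  open import Data.Nat
  open import Data.Nat.Properties
  open import Data.Nat.Divisibility
  open import Data.Nat.Tactic.RingSolver using (solve-∀)
  open Valuation q p-prime public
  open Products
  open Inequalities

  ν-↑-suc : ∀ a m → ν (a ↑ suc m) ≡ ν (a ↑ m) + ν (a + suc m)
  ν-↑-suc a m = ν-* (↑≢0 a m) (λ e → 1+n≢0 (trans (sym (+-suc a m)) e))

  -- Writing a = r + A p with r < p, the multiples of p in (a, a + i] are p (A + 1), …, p (A + M),
  -- and dividing them by p turns their contribution into M + ν (A ↑ M).
  ν-↑-decomposition : ∀ a A r → a ≡ r + A * p → r < p → ∀ i → Σ ℕ λ M →
    (ν (a ↑ i) ≡ M + ν (A ↑ M)) × (p * (A + M) ≤ a + i) × (a + i < p * suc (A + M))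
  ν-↑-decomposition a A r a≡ r<p zero = 0 , refl , lower , upper
    where
    open ≤-Reasoning
    pA≡Ap : p * (A + 0) ≡ A * p
    pA≡Ap = trans (cong (p *_) (+-identityʳ A)) (*-comm p A)
    lower : p * (A + 0) ≤ a + 0
    lower = begin
      p * (A + 0) ≡⟨ pA≡Ap ⟩
      A * p       ≤⟨ m≤n+m (A * p) r ⟩
      r + A * p   ≡⟨ trans (sym a≡) (sym (+-identityʳ a)) ⟩
      a + 0       ∎
    upper : a + 0 < p * suc (A + 0)
    upper = begin-strict
      a + 0           ≡⟨ trans (+-identityʳ a) a≡ ⟩
      r + A * p       <⟨ +-monoˡ-< (A * p) r<p ⟩
      p + A * p       ≡⟨ cong (λ z → p + z) (sym pA≡Ap) ⟩
      p + p * (A + 0) ≡⟨ sym (*-suc p (A + 0)) ⟩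
      p * suc (A + 0) ∎
  ν-↑-decomposition a A r a≡ r<p (suc i) with ν-↑-decomposition a A r a≡ r<p i
  ... | M , ν≡ , lower , upper with a + suc i ≟ p * suc (A + M)
  ...   | yes multiple = suc M , ν≡′ , ≤-reflexive (trans (cong (p *_) (+-suc A M)) (sym multiple)) , upper′
    where
    open ≡-Reasoning
    rearrange : ∀ M S V → (M + S) + suc V ≡ suc M + (S + V)
    rearrange = solve-∀
    ν≡′ : ν (a ↑ suc i) ≡ suc M + ν (A ↑ suc M)
    ν≡′ = begin
      ν (a ↑ suc i)                            ≡⟨ ν-↑-suc a i ⟩
      ν (a ↑ i) + ν (a + suc i)                ≡⟨ cong₂ _+_ ν≡ (trans (cong ν multiple) (ν-p* (λ ()))) ⟩
      (M + ν (A ↑ M)) + suc (ν (suc (A + M)))  ≡⟨ rearrange M _ _ ⟩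
      suc M + (ν (A ↑ M) + ν (suc (A + M)))    ≡⟨ cong (λ z → suc M + (ν (A ↑ M) + ν z)) (sym (+-suc A M)) ⟩
      suc M + (ν (A ↑ M) + ν (A + suc M))      ≡⟨ cong (λ z → suc M + z) (sym (ν-↑-suc A M)) ⟩
      suc M + ν (A ↑ suc M)                    ∎
    upper′ : a + suc i < p * suc (A + suc M)
    upper′ = subst (_< p * suc (A + suc M)) (sym multiple)
               (subst (λ z → p * suc (A + M) < p * suc z) (sym (+-suc A M)) (*-monoʳ-< p (n<1+n (suc (A + M)))))
  ...   | no not-multiple = M , ν≡′ , ≤-trans lower (≤-trans (n≤1+n (a + i)) (≤-reflexive (sym (+-suc a i)))) , upper′
    where
    upper′ : a + suc i < p * suc (A + M)
    upper′ = ≤∧≢⇒< (≤-trans (≤-reflexive (+-suc a i)) upper) not-multiple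
    p∤ : ¬ (p ∣ a + suc i)
    p∤ (divides c a+i≡cp) = <-irrefl refl (≤-<-trans A+M<c c<1+A+M)
      where
      A+M<c : A + M < c
      A+M<c = *-cancelʳ-< p (A + M) c (subst (_< c * p) (*-comm p (A + M))
                (≤-trans (s≤s lower) (≤-reflexive (trans (sym (+-suc a i)) a+i≡cp))))
      c<1+A+M : c < suc (A + M)
      c<1+A+M = *-cancelʳ-< p c (suc (A + M)) (subst (c * p <_) (*-comm p (suc (A + M)))
                  (subst (_< p * suc (A + M)) a+i≡cp upper′))
    ν≡′ : ν (a ↑ suc i) ≡ M + ν (A ↑ M)
    ν≡′ = trans (ν-↑-suc a i) (trans (cong₂ _+_ ν≡ (∤⇒ν≡0 p∤)) (+-identityʳ _))

  legendre-bound : ∀ N → 1 ≤ N → suc q * ν (N !) + 1 ≤ N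
  legendre-bound = <-rec _ bound
    where
    open import Data.Nat.Induction using (<-rec)
    open ≤-Reasoning
    expand₁ : ∀ Q M V → suc Q * (M + V) + 1 ≡ suc Q * M + (suc Q * V + 1)
    expand₁ = solve-∀
    expand₂ : ∀ Q M → suc Q * M + M ≡ suc (suc Q) * M
    expand₂ = solve-∀
    bound : ∀ N → (∀ {M} → M < N → 1 ≤ M → suc q * ν (M !) + 1 ≤ M) → 1 ≤ N → suc q * ν (N !) + 1 ≤ N
    bound N ih 1≤N with ν-↑-decomposition 0 0 0 refl (s≤s z≤n) N
    ... | zero , ν≡ , _ , _ =
      subst (λ z → suc q * z + 1 ≤ N) (sym (trans (trans (cong ν (!≡0↑ N)) ν≡) ν-1))
            (subst (λ z → z + 1 ≤ N) (sym (*-zeroʳ q)) 1≤N)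
    ... | suc m , ν≡ , pM≤N , _ = begin
      suc q * ν (N !) + 1                 ≡⟨ cong (λ z → suc q * z + 1) (trans (cong ν (!≡0↑ N)) ν≡) ⟩
      suc q * (M + ν (0 ↑ M)) + 1         ≡⟨ cong (λ z → suc q * (M + ν z) + 1) (sym (!≡0↑ M)) ⟩
      suc q * (M + ν (M !)) + 1           ≡⟨ expand₁ q M (ν (M !)) ⟩
      suc q * M + (suc q * ν (M !) + 1)   ≤⟨ +-monoʳ-≤ (suc q * M) (ih M<N (s≤s z≤n)) ⟩
      suc q * M + M                       ≡⟨ expand₂ q M ⟩
      p * M                               ≤⟨ pM≤N ⟩
      N                                   ∎
      where
      M = suc m
      M<N : M < N
      M<N = <-≤-trans (subst (M <_) (*-comm M p) (m<m*n M p (s≤s (s≤s z≤n)))) pM≤N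

  ν-↑-legendre : ∀ A M → 1 ≤ M → suc q * ν (A ↑ M) + 1 ≤ A + M
  ν-↑-legendre A M 1≤M =
    ≤-trans (+-monoˡ-≤ 1 (*-monoʳ-≤ (suc q) ν↑≤ν!)) (legendre-bound (A + M) (≤-trans 1≤M (m≤n+m M A)))
    where
    ν↑≤ν! : ν (A ↑ M) ≤ ν ((A + M) !)
    ν↑≤ν! = subst (ν (A ↑ M) ≤_) (trans (sym (ν-* (n!≢0 A) (↑≢0 A M))) (cong ν (sym (!-split A M)))) (m≤n+m _ _)

  ν-↑≡0 : ∀ A M → A + M < p → ν (A ↑ M) ≡ 0
  ν-↑≡0 A zero    _ = ν-1
  ν-↑≡0 A (suc M) A+M<p = trans (ν-↑-suc A M) (cong₂ _+_ (ν-↑≡0 A M (<-trans (+-monoʳ-< A (n<1+n M)) A+M<p)) (∤⇒ν≡0 p∤))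
    where
    p∤ : ¬ (p ∣ A + suc M)
    p∤ d = <-irrefl refl (<-≤-trans A+M<p (∣⇒≤ {{>-nonZero (≤-trans (s≤s z≤n) (≤-reflexive (sym (+-suc A M))))}} d))

  -- Otherwise t = p − r ≤ k would make a + t = (A + 1) p a multiple of p.
  residue-bound : ∀ a A r k → a ≡ r + A * p → r < p → (∀ t → 1 ≤ t → t ≤ k → ¬ (p ∣ a + t)) → k + suc r ≤ p
  residue-bound a A r k a≡ r<p p∤a+t with (p ∸ r) ≤? k
  ... | yes p-r≤k = ⊥-elim (p∤a+t (p ∸ r) (m<n⇒0<n∸m r<p) p-r≤k (divides (suc A) a+t≡))
    where
    open ≡-Reasoning
    a+t≡ : a + (p ∸ r) ≡ suc A * p
    a+t≡ = begin
      a + (p ∸ r)           ≡⟨ cong (_+ (p ∸ r)) a≡ ⟩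
      r + A * p + (p ∸ r)   ≡⟨ trans (cong (_+ (p ∸ r)) (+-comm r (A * p))) (+-assoc (A * p) r (p ∸ r)) ⟩
      A * p + (r + (p ∸ r)) ≡⟨ cong (λ z → A * p + z) (m+[n∸m]≡n (<⇒≤ r<p)) ⟩
      A * p + p             ≡⟨ +-comm (A * p) p ⟩
      suc A * p             ∎
  ... | no p-r≰k = subst (_≤ p) (sym (+-suc k r)) (subst (suc k + r ≤_) (m∸n+n≡m (<⇒≤ r<p)) (+-monoˡ-≤ r (≰⇒> p-r≰k)))

  private
    Ap≤a : ∀ {a A r} → a ≡ r + A * p → A * p ≤ a
    Ap≤a {A = A} {r} a≡ = subst (A * p ≤_) (sym a≡) (m≤n+m (A * p) r)

    quotient≤p-1 : ∀ {a A r} → a ≡ r + A * p → a ≤ p * p ∸ p → A ≤ suc q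
    quotient≤p-1 {a} {A} {r} a≡ a≤p²-p = *-cancelʳ-≤ A (suc q) p (≤-trans (Ap≤a {a} {A} {r} a≡)
      (≤-trans a≤p²-p (≤-reflexive (m+n∸m≡n p (suc q * p)))))

    ≤-from-legendre : ∀ {S L} → 1 ≤ L → suc q * S + 1 ≤ suc q + L → S ≤ L
    ≤-from-legendre {S} {L} 1≤L legendre = *-cancelˡ-≤ (suc q) (begin
      suc q * S ≤⟨ ≤-pred (subst (_≤ suc q + L) (+-comm (suc q * S) 1) legendre) ⟩
      q + L     ≤⟨ +-monoˡ-≤ L (m≤m*n q L {{>-nonZero 1≤L}}) ⟩
      q * L + L ≡⟨ +-comm (q * L) L ⟩
      suc q * L ∎)
      where open ≤-Reasoning

  estimate-a≤p²-p : ∀ a k A r M → a ≡ r + A * p → 2 * k < p → k + suc r ≤ p → a ≤ p * p ∸ p →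
                        p ≤ A + M → 1 ≤ M → k * (M + ν (A ↑ M)) + r < p * M
  estimate-a≤p²-p a k A r M a≡ 2k<p k+r<p a≤p²-p p≤A+M 1≤M with A ≟ suc q
  ... | yes refl = subst (λ z → k * (M + ν (A ↑ M)) + z < p * M) (sym r≡0)
                     (subst (_< p * M) (sym (+-identityʳ _))
                       (bound-S≤M p k M _ 1≤M 2k<p (≤-from-legendre 1≤M (ν-↑-legendre A M 1≤M))))
    where
    r≡0 : r ≡ 0
    r≡0 = n≤0⇒n≡0 (+-cancelʳ-≤ (A * p) r 0 (≤-trans (≤-reflexive (sym a≡))
            (≤-trans a≤p²-p (≤-reflexive (m+n∸m≡n p (suc q * p))))))
  ... | no A≢p-1 with M | p≤A+M | 1≤M | ≤-pred (≤∧≢⇒< (quotient≤p-1 {a} {A} {r} a≡ a≤p²-p) A≢p-1)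
  ...   | suc zero    | p≤A+1 | _ | A≤q = ⊥-elim (<-irrefl refl (≤-<-trans p≤A+1 (subst (_< p) (+-comm 1 A) (s≤s (s≤s A≤q)))))
  ...   | suc (suc m) | _     | _ | A≤q = bound-S<M p k r (suc m) _ 2k<p k+r<p (≤-from-legendre (s≤s z≤n)
    (≤-trans (ν-↑-legendre A (suc (suc m)) (s≤s z≤n)) (≤-reflexive-+ A≤q)))
    where
    ≤-reflexive-+ : A ≤ q → A + suc (suc m) ≤ suc q + suc m
    ≤-reflexive-+ A≤q = subst (A + suc (suc m) ≤_) (+-suc q (suc m)) (+-monoˡ-≤ (suc (suc m)) A≤q)

  estimate : ∀ a k A r M → a ≡ r + A * p → 1 ≤ k → k + 2 ≤ p → k + suc r ≤ p → SizeCondℕ p a k → 1 ≤ M →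
             k * (M + ν (A ↑ M)) + r < p * M
  estimate a k A r M a≡ 1≤k k+2≤p k+r<p size 1≤M with A + M <? p
  ... | yes A+M<p = subst (λ z → k * (M + z) + r < p * M) (sym (ν-↑≡0 A M A+M<p))
                      (subst (λ z → k * z + r < p * M) (sym (+-identityʳ M)) (bound-without-S p k r M 1≤M k+r<p))
  ... | no A+M≮p with size
  ...   | inj₂ (2k<p , a≤p²-p) = estimate-a≤p²-p a k A r M a≡ 2k<p k+r<p a≤p²-p (≮⇒≥ A+M≮p) 1≤M
  ...   | inj₁ p≥min = bound-small-quotient p k r A M _ k+r<p k+2≤p
                         (quotient-small p a k A (Ap≤a {a} {A} {r} a≡) 1≤k k+2≤p p≥min) (≮⇒≥ A+M≮p) kS<A+M
    where
    k≤p-1 : k ≤ suc q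
    k≤p-1 = ≤-trans (≤-pred (≤-pred (subst (_≤ p) (+-comm k 2) k+2≤p))) (n≤1+n q)
    kS<A+M : k * ν (A ↑ M) + 1 ≤ A + M
    kS<A+M = ≤-trans (+-monoˡ-≤ 1 (*-monoˡ-≤ (ν (A ↑ M)) k≤p-1)) (ν-↑-legendre A M 1≤M)

  -- With M multiples of p in (a, a + i], p M ≤ r + i, so the estimate gives k ν (a ↑ i) < i.
  ν-↑-bound : ∀ a k i → 1 ≤ k → k + 2 ≤ p → (∀ t → 1 ≤ t → t ≤ k → ¬ (p ∣ a + t)) → SizeCondℕ p a k → 1 ≤ i →
              k * ν (a ↑ i) < i
  ν-↑-bound a k i 1≤k k+2≤p p∤a+t size 1≤i = bound (a ℕ./ p) (a ℕ.% p) (m≡m%n+[m/n]*n a p) (m%n<n a p)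
    where
    open import Data.Nat.DivMod using (m≡m%n+[m/n]*n; m%n<n)
    bound : ∀ A r → a ≡ r + A * p → r < p → k * ν (a ↑ i) < i
    bound A r a≡ r<p with ν-↑-decomposition a A r a≡ r<p i
    ... | zero , ν≡ , _ , _ = subst (λ z → k * z < i) (sym (trans ν≡ ν-1)) (subst (_< i) (sym (*-zeroʳ k)) 1≤i)
    ... | suc m , ν≡ , p[A+M]≤a+i , _ = subst (λ z → k * z < i) (sym ν≡)
      (+-cancelˡ-< r _ i (subst (_< r + i) (+-comm _ r) (<-≤-trans
        (estimate a k A r (suc m) a≡ 1≤k k+2≤p (residue-bound a A r k a≡ r<p p∤a+t) size (s≤s z≤n)) pM≤r+i)))
      where
      open ≤-Reasoning
      split : ∀ A M p → A * p + p * M ≡ p * (A + M)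
      split = solve-∀
      pM≤r+i : p * suc m ≤ r + i
      pM≤r+i = +-cancelˡ-≤ (A * p) (p * suc m) (r + i) (begin
        A * p + p * suc m ≡⟨ split A (suc m) p ⟩
        p * (A + suc m)   ≤⟨ p[A+M]≤a+i ⟩
        a + i             ≡⟨ cong (_+ i) a≡ ⟩
        r + A * p + i     ≡⟨ trans (cong (_+ i) (+-comm r (A * p))) (+-assoc (A * p) r i) ⟩
        A * p + (r + i)   ∎)

module ClearDenominators where

  import Data.Sum as Sum
  open import Data.Rational.Unnormalised as ℚᵘ using (ℚᵘ; mkℚᵘ; *≤*)
  import Data.Rational.Unnormalised.Properties as ℚᵘP

  private
    toℚᵘ-/ : ∀ i n → ℚ.toℚᵘ (i / suc n) ℚᵘ.≃ mkℚᵘ i n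
    toℚᵘ-/ i n = ℚP.toℚᵘ-fromℚᵘ (mkℚᵘ i n)

    ⊓-≤ : ∀ x y z → x ℚ.⊓ y ℚ.≤ z → (x ℚ.≤ z) ⊎ (y ℚ.≤ z)
    ⊓-≤ x y z h with ℚP.≤-total x y
    ... | inj₁ x≤y = inj₁ (subst (ℚ._≤ z) (ℚP.p≤q⇒p⊓q≡p x≤y) h)
    ... | inj₂ y≤x = inj₂ (subst (ℚ._≤ z) (ℚP.p≥q⇒p⊓q≡q y≤x) h)

    drop-*≤* : ∀ {x y} → x ℚᵘ.≤ y → ℚᵘ.↥ x ℤ.* ℚᵘ.↧ y ℤ.≤ ℚᵘ.↥ y ℤ.* ℚᵘ.↧ x
    drop-*≤* (*≤* h) = h

    pos-p*k : ∀ p k₀ → + p ℤ.* + suc (k₀ ℕ.+ 0) ≡ + (p ℕ.* suc k₀)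
    pos-p*k p k₀ = trans (sym (ℤP.pos-* p _)) (cong (λ z → + (p ℕ.* suc z)) (ℕP.+-identityʳ k₀))

  2u₀≤p⇒ : ∀ p a k₀ → ℕtoℚ 2 ℚ.* u₀ a (suc k₀) ℚ.≤ ℕtoℚ p → 2 ℕ.* a ℕ.≤ p ℕ.* suc k₀
  2u₀≤p⇒ p a k₀ h = ℤP.drop‿+≤+ (subst₂ ℤ._≤_ lhs (pos-p*k p k₀) (drop-*≤* cleared))
    where
    lhs : (+ 2 ℤ.* + a) ℤ.* + 1 ≡ + (2 ℕ.* a)
    lhs = trans (ℤP.*-identityʳ _) (sym (ℤP.pos-* 2 a))
    cleared : mkℚᵘ (+ 2) 0 ℚᵘ.* mkℚᵘ (+ a) k₀ ℚᵘ.≤ mkℚᵘ (+ p) 0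
    cleared = ℚᵘP.≤-respʳ-≃ (toℚᵘ-/ (+ p) 0) (ℚᵘP.≤-respˡ-≃ (ℚᵘP.≃-trans (ℚP.toℚᵘ-homo-* (ℕtoℚ 2) (u₀ a (suc k₀)))
                (ℚᵘP.*-cong (toℚᵘ-/ (+ 2) 0) (toℚᵘ-/ (+ a) k₀))) (ℚP.toℚᵘ-mono-≤ h))

  k+u₀≤p⇒ : ∀ p a k₀ → ℕtoℚ (suc k₀) ℚ.+ u₀ a (suc k₀) ℚ.≤ ℕtoℚ p → suc k₀ ℕ.* suc k₀ ℕ.+ a ℕ.≤ p ℕ.* suc k₀
  k+u₀≤p⇒ p a k₀ h = ℤP.drop‿+≤+ (subst₂ ℤ._≤_ lhs (pos-p*k p k₀) (drop-*≤* cleared))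
    where
    k = suc k₀
    lhs : (+ k ℤ.* + k ℤ.+ + a ℤ.* + 1) ℤ.* + 1 ≡ + (k ℕ.* k ℕ.+ a)
    lhs = trans (ℤP.*-identityʳ _) (trans (cong₂ ℤ._+_ (sym (ℤP.pos-* k k)) (ℤP.*-identityʳ (+ a)))
                                         (sym (ℤP.pos-+ (k ℕ.* k) a)))
    cleared : mkℚᵘ (+ k) 0 ℚᵘ.+ mkℚᵘ (+ a) k₀ ℚᵘ.≤ mkℚᵘ (+ p) 0
    cleared = ℚᵘP.≤-respʳ-≃ (toℚᵘ-/ (+ p) 0) (ℚᵘP.≤-respˡ-≃ (ℚᵘP.≃-trans (ℚP.toℚᵘ-homo-+ (ℕtoℚ k) (u₀ a k))
                (ℚᵘP.+-cong (toℚᵘ-/ (+ k) 0) (toℚᵘ-/ (+ a) k₀))) (ℚP.toℚᵘ-mono-≤ h))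

  SizeCond⇒SizeCondℕ : ∀ p a k₀ → SizeCond p a (suc k₀) → SizeCondℕ p a (suc k₀)
  SizeCond⇒SizeCondℕ p a k₀ (inj₂ large) = inj₂ large
  SizeCond⇒SizeCondℕ p a k₀ (inj₁ p≥min) =
    inj₁ (Sum.map (2u₀≤p⇒ p a k₀) (k+u₀≤p⇒ p a k₀) (⊓-≤ _ _ _ p≥min))

module Applications (q : ℕ) (p-prime : Prime (suc (suc q))) (k₀ : ℕ) where

  open NewtonPolygon q p-prime k₀
  open RisingValuation q p-prime using (ν-↑-bound)
  open NatDifference
  open Products
  open import Data.List using (map; upTo; applyUpTo)
  import Data.List.Properties as ListP
  open import Data.Nat.Combinatorics using (k![n∸k]!∣n!)

  coeff-map-applyUpTo : ∀ (F : ℕ → ℚ) (G : ℕ → ℕ) m j → j ℕ.< m → coeff (map F (applyUpTo G m)) j ≡ F (G j)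
  coeff-map-applyUpTo F G (suc m) zero    _           = refl
  coeff-map-applyUpTo F G (suc m) (suc j) (ℕ.s≤s j<m) = coeff-map-applyUpTo F (G ∘ suc) m j j<m

  coeff-map-upTo-beyond : ∀ (F : ℕ → ℚ) m j → m ℕ.≤ j → coeff (map F (upTo m)) j ≡ 0ℚ
  coeff-map-upTo-beyond F m j m≤j =
    coeff-beyond-length (map F (upTo m)) j (subst (ℕ._≤ j) (sym (trans (ListP.length-map F (upTo m)) (ListP.length-upTo m))) m≤j)

  ν-!-split : ∀ x m → ν ((x ℕ.+ m) !) ≡ ν (x !) ℕ.+ ν (x ↑ m)
  ν-!-split x m = trans (cong ν (!-split x m)) (ν-* (n!≢0 x) (↑≢0 x m))

  ν-!≤ν-↑ : ∀ x m → ν (m !) ℕ.≤ ν (x ↑ m)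
  ν-!≤ν-↑ x m = ℕP.+-cancelˡ-≤ (ν (x !)) _ _ (begin
    ν (x !) ℕ.+ ν (m !)      ≡⟨ sym (ν-* (n!≢0 x) (n!≢0 m)) ⟩
    ν (x ! ℕ.* m !)          ≤⟨ ν-mono-∣ (n!≢0 (x ℕ.+ m)) x!m!∣ ⟩
    ν ((x ℕ.+ m) !)          ≡⟨ ν-!-split x m ⟩
    ν (x !) ℕ.+ ν (x ↑ m)    ∎)
    where
    open ℕP.≤-Reasoning
    x!m!∣ : x ! ℕ.* m ! ℕD.∣ (x ℕ.+ m) !
    x!m!∣ = subst (λ z → x ! ℕ.* z ! ℕD.∣ (x ℕ.+ m) !) (ℕP.m+n∸m≡n x m) (k![n∸k]!∣n! (ℕP.m≤m+n x m))

  p∣⇒1≤ν-↑ : ∀ x m y → x ℕ.< y → y ℕ.≤ x ℕ.+ m → p ℕD.∣ y → 1 ℕ.≤ ν (x ↑ m)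
  p∣⇒1≤ν-↑ x m y x<y y≤x+m p∣y =
    ∣⇒1≤ν (↑≢0 x m) (ℕD.∣-trans (subst (p ℕD.∣_) (sym x+t≡y) p∣y) (∣prodℕ m (λ t → x ℕ.+ t) (y ℕ.∸ x) 1≤t t≤m))
    where
    x+t≡y : x ℕ.+ (y ℕ.∸ x) ≡ y
    x+t≡y = ℕP.m+[n∸m]≡n (ℕP.<⇒≤ x<y)
    1≤t : 1 ℕ.≤ y ℕ.∸ x
    1≤t = ℕP.m<n⇒0<n∸m x<y
    t≤m : y ℕ.∸ x ℕ.≤ m
    t≤m = ℕP.+-cancelˡ-≤ x _ _ (subst (ℕ._≤ x ℕ.+ m) (sym x+t≡y) y≤x+m)

  K*diff-< : ∀ a b c d i → k ℕ.* a ℕ.+ k ℕ.* d ℕ.< k ℕ.* c ℕ.+ i ℕ.+ k ℕ.* b →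
             K ℤ.* (+ a ℤ.- + b) ℤ.< K ℤ.* (+ c ℤ.- + d) ℤ.+ + i
  K*diff-< a b c d i h = subst₂ ℤ._<_ (sym lhs) (sym rhs) (<⇒diff-< (k ℕ.* a) (k ℕ.* b) (k ℕ.* c ℕ.+ i) (k ℕ.* d) h)
    where
    open +-*-Solver
    lhs : K ℤ.* (+ a ℤ.- + b) ≡ + (k ℕ.* a) ℤ.- + (k ℕ.* b)
    lhs = trans (solve 3 (λ K a b → K :* (a :- b) := (K :* a) :- (K :* b)) refl K (+ a) (+ b))
                (sym (cong₂ ℤ._-_ (ℤP.pos-* k a) (ℤP.pos-* k b)))
    rhs : K ℤ.* (+ c ℤ.- + d) ℤ.+ + i ≡ + (k ℕ.* c ℕ.+ i) ℤ.- + (k ℕ.* d)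
    rhs = trans (solve 4 (λ K c d i → K :* (c :- d) :+ i := (K :* c :+ i) :- (K :* d)) refl K (+ c) (+ d) (+ i))
                (sym (cong₂ ℤ._-_ (trans (ℤP.pos-+ (k ℕ.* c) i) (cong (ℤ._+ + i) (ℤP.pos-* k c))) (ℤP.pos-* k d)))

  -- The last n - k + 1 coefficients see a multiple of p among (n - k + a, n + a]; the first ones are
  -- controlled by the bound on ν ((a + 1) ⋯ (a + i)).
  module Fna (a n : ℕ) (as : ℕ → ℤ) (k≤n : k ℕ.≤ n) (k+2≤p : k ℕ.+ 2 ℕ.≤ p)
             (p∣top : p ℕD.∣ (a ℕ.+ (n ℕ.∸ k)) ↑ k) (p∤a₀aₙ : ¬ (p ℕD.∣ ∣ as 0 ∣ ℕ.* ∣ as n ∣))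
             (p∤a+t : ∀ t → 1 ℕ.≤ t → t ℕ.≤ k → ¬ (p ℕD.∣ a ℕ.+ t)) (size : SizeCondℕ p a k) where

    c : ℕ → ℚ
    c i = _/_ (as i) ((i ℕ.+ a) !) {{(i ℕ.+ a) ℕP.!≢0}}

    coeff-fna : ∀ i → i ℕ.≤ n → coeff (fna n a as) i ≡ c i
    coeff-fna i i≤n = coeff-map-applyUpTo _ id (suc n) i (ℕ.s≤s i≤n)

    as≢0 : ∀ i → c i ≢ 0ℚ → as i ≢ + 0
    as≢0 i ci≢0 e = ci≢0 (trans (cong (λ z → _/_ z ((i ℕ.+ a) !) {{(i ℕ.+ a) ℕP.!≢0}}) e)
                                 (ℚP.0/n≡0 ((i ℕ.+ a) !) {{(i ℕ.+ a) ℕP.!≢0}}))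

    p∤⇒as≢0 : ∀ {i} → ¬ (p ℕD.∣ ∣ as i ∣) → as i ≢ + 0
    p∤⇒as≢0 {i} p∤ e = p∤ (subst (λ z → p ℕD.∣ ∣ z ∣) (sym e) (divides 0 refl))

    νc : ∀ i → as i ≢ + 0 → νℚ (c i) ≡ + νℤ (as i) ℤ.- + ν ((i ℕ.+ a) !)
    νc i asᵢ≢0 = νℚ-/ (as i) ((i ℕ.+ a) !) {{(i ℕ.+ a) ℕP.!≢0}} asᵢ≢0

    p∤a₀ : ¬ (p ℕD.∣ ∣ as 0 ∣)
    p∤a₀ d = p∤a₀aₙ (ℕD.∣m⇒∣m*n _ d)

    p∤aₙ : ¬ (p ℕD.∣ ∣ as n ∣)
    p∤aₙ d = p∤a₀aₙ (ℕD.∣n⇒∣m*n ∣ as 0 ∣ d)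

    c₀≢0 : c 0 ≢ 0ℚ
    c₀≢0 = /-≢0 (as 0) (a !) {{a ℕP.!≢0}} (p∤⇒as≢0 p∤a₀)

    cₙ≢0 : c n ≢ 0ℚ
    cₙ≢0 = /-≢0 (as n) ((n ℕ.+ a) !) {{(n ℕ.+ a) ℕP.!≢0}} (p∤⇒as≢0 p∤aₙ)

    top-dominates : ∀ i → i ℕ.≤ n ℕ.∸ k → c i ≢ 0ℚ → νℚ (c n) ℤ.< νℚ (c i)
    top-dominates i i≤n-k ci≢0 with prime∣prodℕ p-prime k _ p∣top
    ... | j , 1≤j , j≤k , p∣y = subst₂ ℤ._<_ (sym (νc n (p∤⇒as≢0 p∤aₙ))) (sym (νc i (as≢0 i ci≢0)))
      (<⇒diff-< (νℤ (as n)) (ν ((n ℕ.+ a) !)) (νℤ (as i)) (ν ((i ℕ.+ a) !)) (begin-strict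
        νℤ (as n) ℕ.+ ν ((i ℕ.+ a) !)                    ≡⟨ cong (ℕ._+ ν ((i ℕ.+ a) !)) (∤⇒ν≡0 p∤aₙ) ⟩
        ν ((i ℕ.+ a) !)                                  <⟨ ℕP.m<m+n _ (p∣⇒1≤ν-↑ (i ℕ.+ a) (n ℕ.∸ i) y i+a<y y≤ p∣y) ⟩
        ν ((i ℕ.+ a) !) ℕ.+ ν ((i ℕ.+ a) ↑ (n ℕ.∸ i))    ≡⟨ sym (ν-!-split (i ℕ.+ a) (n ℕ.∸ i)) ⟩
        ν ((i ℕ.+ a ℕ.+ (n ℕ.∸ i)) !)                    ≡⟨ cong (λ z → ν (z !)) i+a+[n-i]≡n+a ⟩
        ν ((n ℕ.+ a) !)                                  ≤⟨ ℕP.m≤n+m _ (νℤ (as i)) ⟩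
        νℤ (as i) ℕ.+ ν ((n ℕ.+ a) !)                    ∎))
      where
      open ℕP.≤-Reasoning
      y = a ℕ.+ (n ℕ.∸ k) ℕ.+ j
      i≤n : i ℕ.≤ n
      i≤n = ℕP.≤-trans i≤n-k (ℕP.m∸n≤m n k)
      i+a+[n-i]≡n+a : i ℕ.+ a ℕ.+ (n ℕ.∸ i) ≡ n ℕ.+ a
      i+a+[n-i]≡n+a = trans (ℕP.+-comm (i ℕ.+ a) _) (trans (sym (ℕP.+-assoc (n ℕ.∸ i) i a)) (cong (ℕ._+ a) (ℕP.m∸n+n≡m i≤n)))
      i+a<y : i ℕ.+ a ℕ.< y
      i+a<y = begin-strict
        i ℕ.+ a             ≡⟨ ℕP.+-comm i a ⟩
        a ℕ.+ i             ≤⟨ ℕP.+-monoʳ-≤ a i≤n-k ⟩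
        a ℕ.+ (n ℕ.∸ k)     <⟨ ℕP.m<m+n _ 1≤j ⟩
        y                   ∎
      y≤ : y ℕ.≤ i ℕ.+ a ℕ.+ (n ℕ.∸ i)
      y≤ = begin
        a ℕ.+ (n ℕ.∸ k) ℕ.+ j   ≡⟨ ℕP.+-assoc a _ j ⟩
        a ℕ.+ (n ℕ.∸ k ℕ.+ j)   ≤⟨ ℕP.+-monoʳ-≤ a (ℕP.≤-trans (ℕP.+-monoʳ-≤ (n ℕ.∸ k) j≤k) (ℕP.≤-reflexive (ℕP.m∸n+n≡m k≤n))) ⟩
        a ℕ.+ n                 ≡⟨ trans (ℕP.+-comm a n) (sym i+a+[n-i]≡n+a) ⟩
        i ℕ.+ a ℕ.+ (n ℕ.∸ i)   ∎

    below-line : ∀ i → 1 ℕ.≤ i → i ℕ.≤ n → c i ≢ 0ℚ → K ℤ.* νℚ (c 0) ℤ.< K ℤ.* νℚ (c i) ℤ.+ + i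
    below-line i 1≤i i≤n ci≢0 = subst₂ (λ u w → K ℤ.* u ℤ.< K ℤ.* w ℤ.+ + i)
      (sym (trans (νc 0 (p∤⇒as≢0 p∤a₀)) (cong (λ z → + z ℤ.- + ν (a !)) (∤⇒ν≡0 p∤a₀))))
      (sym (trans (νc i (as≢0 i ci≢0)) (cong (λ z → + νℤ (as i) ℤ.- + ν (z !)) (ℕP.+-comm i a))))
      (K*diff-< 0 (ν (a !)) (νℤ (as i)) (ν ((a ℕ.+ i) !)) i (begin-strict
        k ℕ.* 0 ℕ.+ k ℕ.* ν ((a ℕ.+ i) !)          ≡⟨ cong (λ z → k ℕ.* 0 ℕ.+ k ℕ.* z) (ν-!-split a i) ⟩
        k ℕ.* 0 ℕ.+ k ℕ.* (F ℕ.+ S)                ≡⟨ cong (λ z → z ℕ.+ k ℕ.* (F ℕ.+ S)) (ℕP.*-zeroʳ k) ⟩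
        k ℕ.* (F ℕ.+ S)                            ≡⟨ trans (ℕP.*-distribˡ-+ k F S) (ℕP.+-comm (k ℕ.* F) _) ⟩
        k ℕ.* S ℕ.+ k ℕ.* F                        <⟨ ℕP.+-monoˡ-< (k ℕ.* F) (ν-↑-bound a k i (ℕ.s≤s ℕ.z≤n) k+2≤p p∤a+t size 1≤i) ⟩
        i ℕ.+ k ℕ.* F                              ≤⟨ ℕP.+-monoˡ-≤ (k ℕ.* F) (ℕP.m≤n+m i (k ℕ.* νℤ (as i))) ⟩
        k ℕ.* νℤ (as i) ℕ.+ i ℕ.+ k ℕ.* F          ∎))
      where
      open ℕP.≤-Reasoning
      F = ν (a !)
      S = ν (a ↑ i)

    no-factor : ¬ HasFactorOfDegree (fna n a as) k
    no-factor = no-factor-of-degree (fna n a as) n c coeff-fna (λ i n<i → coeff-map-upTo-beyond _ (suc n) i n<i)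
                  c₀≢0 cₙ≢0 top-dominates below-line

  module Laguerre (a n : ℕ) (k≤n : k ℕ.≤ n) (k+2≤p : k ℕ.+ 2 ℕ.≤ p)
                  (p∣top : p ℕD.∣ prodℕ k (λ i → ((n ℕ.∸ k) ℕ.+ i) ℕ.* (a ℕ.+ (n ℕ.∸ k) ℕ.+ i)))
                  (p∤a+t : ∀ t → 1 ℕ.≤ t → t ℕ.≤ k → ¬ (p ℕD.∣ a ℕ.+ t)) (size : SizeCondℕ p a k) where

    -- P j = (j + a + 1) ⋯ (n + a), so that the coefficient of x^j is ± P j / ((n − j)! j!).
    P : ℕ → ℕ
    P j = prodℕ (n ℕ.∸ j) (λ i → j ℕ.+ i ℕ.+ a)

    c : ℕ → ℚ
    c j = _/_ ((ℤ.- (+ 1)) ℤ.^ j ℤ.* + P j) ((n ℕ.∸ j) ! ℕ.* j !) {{(n ℕ.∸ j) ℕP.!* j !≢0}}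

    coeff-laguerre : ∀ i → i ℕ.≤ n → coeff (laguerre n a) i ≡ c i
    coeff-laguerre i i≤n = coeff-map-applyUpTo _ id (suc n) i (ℕ.s≤s i≤n)

    P≡↑ : ∀ j → P j ≡ (j ℕ.+ a) ↑ (n ℕ.∸ j)
    P≡↑ j = prodℕ-cong (n ℕ.∸ j) _ _ λ t _ _ →
      trans (ℕP.+-assoc j t a) (trans (cong (j ℕ.+_) (ℕP.+-comm t a)) (sym (ℕP.+-assoc j a t)))

    P≢0 : ∀ j → P j ≢ 0
    P≢0 j e = ↑≢0 (j ℕ.+ a) (n ℕ.∸ j) (trans (sym (P≡↑ j)) e)

    ∣±P∣≡P : ∀ j → ∣ (ℤ.- (+ 1)) ℤ.^ j ℤ.* + P j ∣ ≡ P j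
    ∣±P∣≡P j = trans (ℤP.abs-* ((ℤ.- (+ 1)) ℤ.^ j) (+ P j)) (trans (cong (ℕ._* P j) (∣-1^j∣ j)) (ℕP.*-identityˡ (P j)))
      where
      ∣-1^j∣ : ∀ j → ∣ (ℤ.- (+ 1)) ℤ.^ j ∣ ≡ 1
      ∣-1^j∣ zero    = refl
      ∣-1^j∣ (suc j) = trans (ℤP.abs-* (ℤ.- (+ 1)) ((ℤ.- (+ 1)) ℤ.^ j)) (trans (cong (1 ℕ.*_) (∣-1^j∣ j)) refl)

    ±P≢0 : ∀ j → (ℤ.- (+ 1)) ℤ.^ j ℤ.* + P j ≢ + 0
    ±P≢0 j e = P≢0 j (trans (sym (∣±P∣≡P j)) (cong ∣_∣ e))

    c≢0 : ∀ j → c j ≢ 0ℚ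
    c≢0 j = /-≢0 _ ((n ℕ.∸ j) ! ℕ.* j !) {{(n ℕ.∸ j) ℕP.!* j !≢0}} (±P≢0 j)

    νc : ∀ j → νℚ (c j) ≡ + ν (P j) ℤ.- + (ν ((n ℕ.∸ j) !) ℕ.+ ν (j !))
    νc j = trans (νℚ-/ _ ((n ℕ.∸ j) ! ℕ.* j !) {{(n ℕ.∸ j) ℕP.!* j !≢0}} (±P≢0 j))
                 (cong₂ (λ u w → + u ℤ.- + w) (cong ν (∣±P∣≡P j)) (ν-* (n!≢0 (n ℕ.∸ j)) (n!≢0 j)))

    ν-n!-split : ∀ i → i ℕ.≤ n → ν (n !) ≡ ν (i !) ℕ.+ ν (i ↑ (n ℕ.∸ i))
    ν-n!-split i i≤n = trans (cong (λ z → ν (z !)) (sym (ℕP.m+[n∸m]≡n i≤n))) (ν-!-split i (n ℕ.∸ i))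

    binomial : ∀ i → i ℕ.≤ n → ν ((n ℕ.∸ i) !) ℕ.+ ν (i !) ℕ.≤ ν (n !)
    binomial i i≤n = ℕP.≤-trans (ℕP.≤-reflexive (ℕP.+-comm (ν ((n ℕ.∸ i) !)) (ν (i !))))
                       (ℕP.≤-trans (ℕP.+-monoʳ-≤ (ν (i !)) (ν-!≤ν-↑ i (n ℕ.∸ i))) (ℕP.≤-reflexive (sym (ν-n!-split i i≤n))))

    νPₙ≡0 : ν (P n) ≡ 0
    νPₙ≡0 = subst (λ m → ν (prodℕ m (λ i → n ℕ.+ i ℕ.+ a)) ≡ 0) (sym (ℕP.n∸n≡0 n)) ν-1

    ν[n-n]!≡0 : ν ((n ℕ.∸ n) !) ≡ 0
    ν[n-n]!≡0 = subst (λ m → ν (m !) ≡ 0) (sym (ℕP.n∸n≡0 n)) ν-1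

    top-dominates : ∀ i → i ℕ.≤ n ℕ.∸ k → c i ≢ 0ℚ → νℚ (c n) ℤ.< νℚ (c i)
    top-dominates i i≤n-k _ with prime∣prodℕ p-prime k _ p∣top
    ... | j , 1≤j , j≤k , p∣yz = subst₂ ℤ._<_ (sym (νc n)) (sym (νc i))
      (<⇒diff-< (ν (P n)) (ν ((n ℕ.∸ n) !) ℕ.+ ν (n !)) (ν (P i)) (ν ((n ℕ.∸ i) !) ℕ.+ ν (i !))
        (subst₂ ℕ._<_ (cong (ℕ._+ _) (sym νPₙ≡0)) (cong (λ z → ν (P i) ℕ.+ (z ℕ.+ ν (n !))) (sym ν[n-n]!≡0))
          ([ multiple-of-p-in-range , multiple-of-p-in-a-range ]′ (euclidsLemma _ _ p-prime p∣yz))))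
      where
      open ℕP.≤-Reasoning
      y = n ℕ.∸ k ℕ.+ j
      i≤n : i ℕ.≤ n
      i≤n = ℕP.≤-trans i≤n-k (ℕP.m∸n≤m n k)
      y≤n : y ℕ.≤ n
      y≤n = ℕP.≤-trans (ℕP.+-monoʳ-≤ (n ℕ.∸ k) j≤k) (ℕP.≤-reflexive (ℕP.m∸n+n≡m k≤n))
      i<y : i ℕ.< y
      i<y = ℕP.<-≤-trans (ℕP.m<m+n i 1≤j) (ℕP.+-monoˡ-≤ j i≤n-k)
      multiple-of-p-in-range : p ℕD.∣ y → ν ((n ℕ.∸ i) !) ℕ.+ ν (i !) ℕ.< ν (P i) ℕ.+ ν (n !)
      multiple-of-p-in-range p∣y = begin-strict
        ν ((n ℕ.∸ i) !) ℕ.+ ν (i !)                   ≤⟨ ℕP.+-monoˡ-≤ (ν (i !)) (subst (λ z → ν ((n ℕ.∸ i) !) ℕ.≤ ν z) (sym (P≡↑ i)) (ν-!≤ν-↑ (i ℕ.+ a) (n ℕ.∸ i))) ⟩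
        ν (P i) ℕ.+ ν (i !)                           <⟨ ℕP.+-monoʳ-< (ν (P i)) (ℕP.m<m+n _ (p∣⇒1≤ν-↑ i (n ℕ.∸ i) y i<y
                                                           (ℕP.≤-trans y≤n (ℕP.≤-reflexive (sym (ℕP.m+[n∸m]≡n i≤n)))) p∣y)) ⟩
        ν (P i) ℕ.+ (ν (i !) ℕ.+ ν (i ↑ (n ℕ.∸ i)))   ≡⟨ cong (ν (P i) ℕ.+_) (sym (ν-n!-split i i≤n)) ⟩
        ν (P i) ℕ.+ ν (n !)                           ∎
      multiple-of-p-in-a-range : p ℕD.∣ a ℕ.+ (n ℕ.∸ k) ℕ.+ j → ν ((n ℕ.∸ i) !) ℕ.+ ν (i !) ℕ.< ν (P i) ℕ.+ ν (n !)
      multiple-of-p-in-a-range p∣a+y = begin-strict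
        ν ((n ℕ.∸ i) !) ℕ.+ ν (i !) ≤⟨ binomial i i≤n ⟩
        ν (n !)                     <⟨ ℕP.m<n+m _ (subst (λ z → 1 ℕ.≤ ν z) (sym (P≡↑ i)) (p∣⇒1≤ν-↑ (i ℕ.+ a) (n ℕ.∸ i) (a ℕ.+ y)
                                         (subst (ℕ._< a ℕ.+ y) (ℕP.+-comm a i) (ℕP.+-monoʳ-< a i<y)) a+y≤ p∣a+y′)) ⟩
        ν (P i) ℕ.+ ν (n !)         ∎
        where
        p∣a+y′ : p ℕD.∣ a ℕ.+ y
        p∣a+y′ = subst (p ℕD.∣_) (ℕP.+-assoc a (n ℕ.∸ k) j) p∣a+y
        a+y≤ : a ℕ.+ y ℕ.≤ i ℕ.+ a ℕ.+ (n ℕ.∸ i)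
        a+y≤ = subst (a ℕ.+ y ℕ.≤_) (trans (cong (a ℕ.+_) (sym (ℕP.m+[n∸m]≡n i≤n)))
                 (trans (sym (ℕP.+-assoc a i _)) (cong (ℕ._+ (n ℕ.∸ i)) (ℕP.+-comm a i)))) (ℕP.+-monoʳ-≤ a y≤n)

    below-line : ∀ i → 1 ℕ.≤ i → i ℕ.≤ n → c i ≢ 0ℚ → K ℤ.* νℚ (c 0) ℤ.< K ℤ.* νℚ (c i) ℤ.+ + i
    below-line i 1≤i i≤n _ = subst₂ (λ u w → K ℤ.* u ℤ.< K ℤ.* w ℤ.+ + i)
      (sym (trans (νc 0) (cong (λ z → + z ℤ.- + N) νP₀≡)))
      (sym (νc i))
      (K*diff-< (S ℕ.+ Q) N Q B i (begin-strict
        k ℕ.* (S ℕ.+ Q) ℕ.+ k ℕ.* B      ≡⟨ cong (ℕ._+ k ℕ.* B) (trans (ℕP.*-distribˡ-+ k S Q) (ℕP.+-comm (k ℕ.* S) _)) ⟩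
        k ℕ.* Q ℕ.+ k ℕ.* S ℕ.+ k ℕ.* B  ≡⟨ ℕP.+-assoc (k ℕ.* Q) _ _ ⟩
        k ℕ.* Q ℕ.+ (k ℕ.* S ℕ.+ k ℕ.* B) <⟨ ℕP.+-monoʳ-< (k ℕ.* Q) (ℕP.+-mono-<-≤
                                               (ν-↑-bound a k i (ℕ.s≤s ℕ.z≤n) k+2≤p p∤a+t size 1≤i) (ℕP.*-monoʳ-≤ k B≤N)) ⟩
        k ℕ.* Q ℕ.+ (i ℕ.+ k ℕ.* N)      ≡⟨ sym (ℕP.+-assoc (k ℕ.* Q) i _) ⟩
        k ℕ.* Q ℕ.+ i ℕ.+ k ℕ.* N        ∎))
      where
      open ℕP.≤-Reasoning
      S = ν (a ↑ i)
      Q = ν (P i)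
      N = ν ((n ℕ.∸ 0) !) ℕ.+ ν (0 !)
      B = ν ((n ℕ.∸ i) !) ℕ.+ ν (i !)
      B≤N : B ℕ.≤ N
      B≤N = ℕP.≤-trans (binomial i i≤n) (ℕP.m≤m+n _ _)
      P₀≡ : P 0 ≡ a ↑ i ℕ.* P i
      P₀≡ = begin-equality
        prodℕ n (λ t → t ℕ.+ a)                           ≡⟨ prodℕ-cong n _ _ (λ t _ _ → ℕP.+-comm t a) ⟩
        a ↑ n                                             ≡⟨ cong (a ↑_) (sym (ℕP.m+[n∸m]≡n i≤n)) ⟩
        a ↑ (i ℕ.+ (n ℕ.∸ i))                             ≡⟨ prodℕ-+ i (n ℕ.∸ i) (λ t → a ℕ.+ t) ⟩
        a ↑ i ℕ.* prodℕ (n ℕ.∸ i) (λ t → a ℕ.+ (i ℕ.+ t)) ≡⟨ cong (a ↑ i ℕ.*_) (prodℕ-cong (n ℕ.∸ i) _ _ (λ t _ _ → ℕP.+-comm a (i ℕ.+ t))) ⟩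
        a ↑ i ℕ.* P i                                     ∎
      νP₀≡ : ν (P 0) ≡ S ℕ.+ Q
      νP₀≡ = trans (cong ν P₀≡) (ν-* (↑≢0 a i) (P≢0 i))

    no-factor : ¬ HasFactorOfDegree (laguerre n a) k
    no-factor = no-factor-of-degree (laguerre n a) n c coeff-laguerre (λ i n<i → coeff-map-upTo-beyond _ (suc n) i n<i)
                  (c≢0 0) (c≢0 n) top-dominates below-line

open import Data.Nat using (_+_; _*_; _∸_; _≤_; _<_)
open import Data.Nat.Divisibility using (_∣_; ∣-trans)
open import Data.Integer.Divisibility as ℤD using ()

p∤↑⇒p∤a+t : ∀ {p} a k → ¬ (p ∣ prodℕ k (λ i → a + i)) → ∀ t → 1 ≤ t → t ≤ k → ¬ (p ∣ a + t)
p∤↑⇒p∤a+t a k p∤ t 1≤t t≤k p∣ = p∤ (∣-trans p∣ (Products.∣prodℕ k (λ i → a + i) t 1≤t t≤k))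

fna-no-factor : ∀ a n k₀ (as : ℕ → ℤ) p → Prime p → suc k₀ + 2 ≤ p → suc k₀ ≤ n →
  p ∣ prodℕ (suc k₀) (λ i → a + (n ∸ suc k₀) + i) → ¬ ((+ p) ℤD.∣ (as 0 ℤ.* as n)) →
  ¬ (p ∣ prodℕ (suc k₀) (λ i → a + i)) → SizeCond p a (suc k₀) → ¬ HasFactorOfDegree (fna n a as) (suc k₀)
fna-no-factor _ _ _ _ 0 ()
fna-no-factor _ _ _ _ 1 ()
fna-no-factor a n k₀ as (suc (suc q)) p-prime k+2≤p k≤n p∣top p∤a₀aₙ p∤↑ size =
  Applications.Fna.no-factor q p-prime k₀ a n as k≤n k+2≤p p∣top
    (λ p∣ → p∤a₀aₙ (subst (_ ∣_) (sym (ℤP.abs-* (as 0) (as n))) p∣))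
    (p∤↑⇒p∤a+t a (suc k₀) p∤↑) (ClearDenominators.SizeCond⇒SizeCondℕ _ a k₀ size)

laguerre-no-factor : ∀ a n k₀ p → Prime p → suc k₀ + 2 ≤ p → suc k₀ ≤ n →
  p ∣ prodℕ (suc k₀) (λ i → ((n ∸ suc k₀) + i) * (a + (n ∸ suc k₀) + i)) →
  ¬ (p ∣ prodℕ (suc k₀) (λ i → a + i)) → SizeCond p a (suc k₀) → ¬ HasFactorOfDegree (laguerre n a) (suc k₀)
laguerre-no-factor _ _ _ 0 ()
laguerre-no-factor _ _ _ 1 ()
laguerre-no-factor a n k₀ (suc (suc q)) p-prime k+2≤p k≤n p∣top p∤↑ size =
  Applications.Laguerre.no-factor q p-prime k₀ a n k≤n k+2≤p p∣top
    (p∤↑⇒p∤a+t a (suc k₀) p∤↑) (ClearDenominators.SizeCond⇒SizeCondℕ _ a k₀ size)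

lemma1 : (a n k : ℕ) → 0 < a → 1 ≤ k → 2 * k ≤ n → (as : ℕ → ℤ) →
    ((Σ ℕ λ p → Prime p × (k + 2 ≤ p)
        × (p ∣ prodℕ k (λ i → a + (n ∸ k) + i))
        × ¬ ((+ p) ℤD.∣ (as 0 ℤ.* as n))
        × ¬ (p ∣ prodℕ k (λ i → a + i))
        × SizeCond p a k)
      → ¬ HasFactorOfDegree (fna n a as) k)
    × ((Σ ℕ λ p → Prime p × (k + 2 ≤ p)
        × (p ∣ prodℕ k (λ i → ((n ∸ k) + i) * (a + (n ∸ k) + i)))
        × ¬ (p ∣ prodℕ k (λ i → a + i))
        × SizeCond p a k)
      → ¬ HasFactorOfDegree (laguerre n a) k)
lemma1 a n zero     _ () _ _
lemma1 a n (suc k₀) _ _ 2k≤n as =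
  (λ (p , p-prime , k+2≤p , p∣top , p∤a₀aₙ , p∤↑ , size) →
     fna-no-factor a n k₀ as p p-prime k+2≤p k≤n p∣top p∤a₀aₙ p∤↑ size) ,
  (λ (p , p-prime , k+2≤p , p∣top , p∤↑ , size) →
     laguerre-no-factor a n k₀ p p-prime k+2≤p k≤n p∣top p∤↑ size)
  where
  k≤n : suc k₀ ≤ n
  k≤n = ℕP.≤-trans (ℕP.m≤m+n (suc k₀) _) 2k≤n
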